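{- Let $n\ge1$, let $\pi\in B_n$, and let $\tilde A=u[\pi]$ for some $u\in\mathbb{U}^C_\pi$. If each of the first $2n-1$ columns of $\tilde A$ contains an even number of $1$'s, then every matrix in the coset $\tilde A\mathbb{B}_C^+=\{\tilde AB:B\in\mathbb{B}_C^+\}$ contains an odd number of $1$'s, and $$\sum_{K\in\tilde A\mathbb{B}_C^+}(-1)^{o(K)}=-|\mathbb{B}_C^+|=-2^{n^2},$$ where $o(K)$ is the number of $1$'s in $K$.
   Context: All matrices are over $\mathbb{Z}_2$. Let $J$ be the $n\times n$ antidiagonal matrix of $1$'s, $M=\begin{pmatrix}0&J\\-J&0\end{pmatrix}$, and $Sp_{2n}(\mathbb{Z}_2)=\{A\in SL_{2n}(\mathbb{Z}_2):A^TMA=M\}$. Let $\mathbb{B}_C^+$ be the set of upper triangular matrices in $Sp_{2n}(\mathbb{Z}_2)$ and $\mathbb{U}_C^-$ the set of lower triangular matrices with $1$'s on the diagonal in $Sp_{2n}(\mathbb{Z}_2)$. $B_n$ is the group of permutations $\pi$ of $\{1,\dots,2n\}$ with $\pi(2n+1-i)=2n+1-\pi(i)$ for all $i$; $\pi$ is identified with the permutation matrix $[\pi]$, $[\pi]_{i,j}=1$ iff $i=\pi(j)$. $\mathbb{U}^C_\pi=\mathbb{U}_C^-\cap([\pi]\mathbb{U}_C^-[\pi]^{ -1})$. -}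

module Defs where

open import Data.Bool using (Bool; true; false; _∧_; _xor_; not)
import Data.Bool.Properties as BoolP
open import Data.Nat using (ℕ; zero; suc; _+_; _∸_; _≤_; _<_; _%_)
import Data.Nat
import Data.Integer
import Data.Nat.Properties as ℕP
open import Data.Fin using (Fin; zero; suc; toℕ; splitAt; opposite; punchIn)
open import Data.Fin.Properties using (all?) renaming (_≟_ to _≟ᶠ_)
open import Data.Fin.Permutation using (Permutation′; _⟨$⟩ʳ_; flip)
open import Data.Sum using (inj₁; inj₂)
open import Data.Vec using (Vec; []; _∷_; lookup; tabulate)
open import Data.Vec.Properties using (≡-dec)
open import Data.List using (List; []; _∷_; concatMap; filter; foldr; map; length)
open import Data.List.Relation.Unary.Any using (Any; any?)
open import Data.Product using (Σ; _×_; _,_; ∃)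
open import Data.Integer using (ℤ; +_; -_)
open import Relation.Nullary using (Dec; yes; no; does; ¬_)
open import Relation.Nullary.Decidable using (_×-dec_; _→-dec_)
open import Relation.Binary.PropositionalEquality using (_≡_)

-- Z₂ is modelled by Bool: addition = xor, multiplication = ∧, 0 = false, 1 = true.
-- In Z₂ we have -x = x.
neg₂ : Bool → Bool
neg₂ x = x

Σ₂ : ∀ k → (Fin k → Bool) → Bool
Σ₂ zero    f = false
Σ₂ (suc k) f = f zero xor Σ₂ k (λ i → f (suc i))

Mat : ℕ → Set
Mat k = Vec (Vec Bool k) k

_[_,_] : ∀ {k} → Mat k → Fin k → Fin k → Bool
A [ i , j ] = lookup (lookup A i) j

mkMat : ∀ {k} → (Fin k → Fin k → Bool) → Mat k
mkMat f = tabulate (λ i → tabulate (λ j → f i j))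

_*ᴹ_ : ∀ {k} → Mat k → Mat k → Mat k
_*ᴹ_ {k} A B = mkMat (λ i j → Σ₂ k (λ l → A [ i , l ] ∧ B [ l , j ]))

infixl 7 _*ᴹ_

transpose : ∀ {k} → Mat k → Mat k
transpose A = mkMat (λ i j → A [ j , i ])

-- determinant over Z₂ via Laplace expansion along the first row (signs vanish mod 2)
det : ∀ k → Mat k → Bool
det zero    A = true
det (suc k) A = Σ₂ (suc k) (λ j → A [ zero , j ] ∧
                  det k (mkMat (λ r c → A [ suc r , punchIn j c ])))

Jm : ∀ n → Mat n
Jm n = mkMat (λ i j → does (toℕ i + toℕ j ℕP.≟ (n ∸ 1)))

Mm : ∀ n → Mat (n + n)
Mm n = mkMat entry
  where
  entry : Fin (n + n) → Fin (n + n) → Bool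
  entry i j with splitAt n i | splitAt n j
  ... | inj₁ a | inj₂ b = Jm n [ a , b ]
  ... | inj₂ a | inj₁ b = neg₂ (Jm n [ a , b ])
  ... | _      | _      = false

InSp : ∀ n → Mat (n + n) → Set
InSp n A = (det (n + n) A ≡ true) × (transpose A *ᴹ Mm n *ᴹ A ≡ Mm n)

UpperTri : ∀ {k} → Mat k → Set
UpperTri {k} A = ∀ (i j : Fin k) → toℕ j < toℕ i → A [ i , j ] ≡ false

LowerUni : ∀ {k} → Mat k → Set
LowerUni {k} A = (∀ (i j : Fin k) → toℕ i < toℕ j → A [ i , j ] ≡ false)
               × (∀ (i : Fin k) → A [ i , i ] ≡ true)

InBplus : ∀ n → Mat (n + n) → Set
InBplus n A = UpperTri A × InSp n A

InUminus : ∀ n → Mat (n + n) → Set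
InUminus n A = LowerUni A × InSp n A

-- B_n : permutations of {1..2n} with π(2n+1-i) = 2n+1-π(i)   (0-indexed: opposite)
InBn : ∀ n → Permutation′ (n + n) → Set
InBn n π = ∀ (i : Fin (n + n)) → π ⟨$⟩ʳ (opposite i) ≡ opposite (π ⟨$⟩ʳ i)

permMat : ∀ {k} → Permutation′ k → Mat k
permMat π = mkMat (λ i j → does (i ≟ᶠ (π ⟨$⟩ʳ j)))

-- [π]⁻¹ = [π⁻¹]
permMatInv : ∀ {k} → Permutation′ k → Mat k
permMatInv π = permMat (flip π)

InUpi : ∀ n → Permutation′ (n + n) → Mat (n + n) → Set
InUpi n π u = InUminus n u
            × Σ (Mat (n + n)) (λ v → InUminus n v × (u ≡ permMat π *ᴹ v *ᴹ permMatInv π))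

Σℕ : ∀ k → (Fin k → ℕ) → ℕ
Σℕ zero    f = 0
Σℕ (suc k) f = f zero Data.Nat.+ Σℕ k (λ i → f (suc i))

bit : Bool → ℕ
bit true  = 1
bit false = 0

ones : ∀ {k} → Mat k → ℕ
ones {k} A = Σℕ k (λ i → Σℕ k (λ j → bit (A [ i , j ])))

colOnes : ∀ {k} → Mat k → Fin k → ℕ
colOnes {k} A j = Σℕ k (λ i → bit (A [ i , j ]))

sign : ℕ → ℤ
sign m = (- (+ 1)) Data.Integer.^ m

sumℤ : List ℤ → ℤ
sumℤ = foldr Data.Integer._+_ (+ 0)

-- Enumeration of all vectors / all matrices over Z₂ (each exactly once)
allVecs : ∀ {a} {A : Set a} → List A → ∀ k → List (Vec A k)
allVecs xs zero    = [] ∷ []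
allVecs xs (suc k) = concatMap (λ x → map (x ∷_) (allVecs xs k)) xs

allMats : ∀ k → List (Mat k)
allMats k = allVecs (allVecs (true ∷ false ∷ []) k) k

_≟ᴹ_ : ∀ {k} (A B : Mat k) → Dec (A ≡ B)
_≟ᴹ_ = ≡-dec (≡-dec BoolP._≟_)

InSp? : ∀ n (A : Mat (n + n)) → Dec (InSp n A)
InSp? n A = (det (n + n) A BoolP.≟ true) ×-dec ((transpose A *ᴹ Mm n *ᴹ A) ≟ᴹ Mm n)

UpperTri? : ∀ {k} (A : Mat k) → Dec (UpperTri A)
UpperTri? A = all? (λ i → all? (λ j → (toℕ j ℕP.<? toℕ i) →-dec (A [ i , j ] BoolP.≟ false)))

InBplus? : ∀ n (A : Mat (n + n)) → Dec (InBplus n A)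
InBplus? n A = UpperTri? A ×-dec InSp? n A

-- the finite set 𝔹_C^+ as a list (without repetitions)
BplusList : ∀ n → List (Mat (n + n))
BplusList n = filter (InBplus? n) (allMats (n + n))

cardBplus : ∀ n → ℕ
cardBplus n = length (BplusList n)

InCoset : ∀ n → Mat (n + n) → Mat (n + n) → Set
InCoset n At K = Any (λ B → K ≡ At *ᴹ B) (BplusList n)

InCoset? : ∀ n At (K : Mat (n + n)) → Dec (InCoset n At K)
InCoset? n At K = any? (λ B → K ≟ᴹ (At *ᴹ B)) (BplusList n)

cosetList : ∀ n → Mat (n + n) → List (Mat (n + n))
cosetList n At = filter (InCoset? n At) (allMats (n + n))

cosetSignSum : ∀ n → Mat (n + n) → ℤ
cosetSignSum n At = sumℤ (map (λ K → sign (ones K)) (cosetList n At))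

{-# OPTIONS --safe #-}

-- Mod 2, the number of ones of a matrix X is 1ᵀ X 1.  The last column of the lower unitriangular u
-- has odd weight and right multiplication by [π] permutes column weights, so the hypothesis forces
-- 1ᵀ Ã = (0, …, 0, 1); hence o(Ã B) ≡ (last row sum of B) = B₂ₙ,₂ₙ = 1 for B ∈ 𝔹_C^+, as upper
-- triangular symplectic matrices have unit diagonal.  Ã is invertible (u⁻¹ = M uᵀ M), so B ↦ Ã B is
-- a bijection onto the coset and the signed sum is −|𝔹_C^+|.  Finally, every element of 𝔹_C^+ in
-- dimension 2n + 2 arises exactly once by bordering some B′ ∈ 𝔹_C^+ of dimension 2n with an
-- arbitrary last column s ∈ Z₂²ⁿ, an arbitrary corner c and the unique compatible top row; as
-- n² + 2n + 1 = (n + 1)², this gives |𝔹_C^+| = 2^(n²).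
module Submission where

open import Defs
open import Data.Nat using (ℕ; suc; _+_; _*_; _^_; _≤_; _<_; _∸_; _%_)
open import Data.Fin using (Fin; toℕ)
open import Data.Fin.Permutation using (Permutation′)
open import Data.Integer using (ℤ; +_; -_)
open import Data.Product using (_×_)
open import Relation.Binary.PropositionalEquality using (_≡_)

open import Algebra using (CommutativeRing)
open import Data.Bool using (Bool; true; false; _∧_; _xor_; if_then_else_)
open import Data.Bool.Properties
  using (xor-∧-commutativeRing; xor-comm; xor-assoc; xor-same; xor-identityʳ;
         ∧-comm; ∧-assoc; ∧-zeroʳ; ∧-identityʳ; ∧-distribˡ-xor)
open import Data.Empty using (⊥-elim)
open import Data.Fin using (zero; suc; splitAt; punchIn; punchOut; fromℕ<)
open import Data.Fin.Permutation using (_⟨$⟩ʳ_; _⟨$⟩ˡ_; inverseʳ; inverseˡ; flip)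
open import Data.Fin.Properties
  using (toℕ<n; toℕ-fromℕ<; toℕ-injective; toℕ-↑ˡ; toℕ-↑ʳ; splitAt⁻¹-↑ˡ; splitAt⁻¹-↑ʳ; punchIn-punchOut)
  renaming (_≟_ to _≟ᶠ_)
open import Data.Integer using (-[1+_]) renaming (_+_ to _+ℤ_)
import Data.Integer.Properties as ℤP
open import Data.List using (List; []; _∷_; length; map; _++_; concatMap; cartesianProductWith; cartesianProduct)
open import Data.List.Properties using (length-map; length-++)
open import Data.List.Membership.Propositional using (_∈_)
open import Data.List.Membership.Propositional.Properties
  using (∈-map⁺; ∈-map⁻; ∈-filter⁺; ∈-filter⁻; ∈-cartesianProductWith⁺; ∈-cartesianProduct⁺; ∈-cartesianProduct⁻)
open import Data.List.Membership.Propositional.Properties.WithK using (unique∧set⇒bag)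
open import Data.List.Relation.Binary.BagAndSetEquality using (∼bag⇒↭)
open import Data.List.Relation.Binary.Permutation.Propositional.Properties using (↭-length)
import Data.List.Relation.Unary.All as All
import Data.List.Relation.Unary.AllPairs as AllPairs
open import Data.List.Relation.Unary.Any using (here; there)
import Data.List.Relation.Unary.Any.Properties as Any
open import Data.List.Relation.Unary.Unique.Propositional using (Unique)
open import Data.List.Relation.Unary.Unique.Propositional.Properties
  using (map⁺; filter⁺; cartesianProductWith⁺; cartesianProduct⁺)
open import Data.Nat using (zero; z≤n; s≤s; z<s; s<s; _≟_; _<?_; _<ᵇ_)
open import Data.Nat.DivMod using (%-distribˡ-+)
open import Data.Nat.Properties
open import Data.Nat.Tactic.RingSolver using (solve-∀)
open import Data.Product using (_,_; proj₁; proj₂)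
open import Data.Sum using (inj₁; inj₂)
open import Data.Vec using (Vec; []; _∷_; lookup; tabulate; replicate)
open import Data.Vec.Properties using (lookup∘tabulate; tabulate∘lookup; tabulate-cong; ∷-injective)
open import Function using (_∘_; _$_; _∋_)
open import Function.Bundles using (_⇔_; mk⇔)
open import Relation.Binary.Definitions using (tri<; tri≈; tri>)
open import Relation.Binary.PropositionalEquality
  using (_≢_; refl; sym; trans; cong; cong₂; subst; subst₂; module ≡-Reasoning)
open import Relation.Nullary using (does; yes; no; contradiction)
open import Relation.Nullary.Decidable using (dec-true; dec-false; does-⇔)

open import Algebra.Properties.CommutativeSemigroup
  (CommutativeRing.+-commutativeSemigroup xor-∧-commutativeRing) using (interchange)
open import Algebra.Properties.CommutativeSemigroup +-commutativeSemigroup using (x∙yz≈y∙xz)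

⨁ : ℕ → (ℕ → Bool) → Bool
⨁ zero    f = false
⨁ (suc K) f = f 0 xor ⨁ K (f ∘ suc)

Σ₂-cong : ∀ K {f g : Fin K → Bool} → (∀ i → f i ≡ g i) → Σ₂ K f ≡ Σ₂ K g
Σ₂-cong zero    f≗g = refl
Σ₂-cong (suc K) f≗g = cong₂ _xor_ (f≗g zero) (Σ₂-cong K (f≗g ∘ suc))

Σ₂-zero : ∀ k {f : Fin k → Bool} → (∀ i → f i ≡ false) → Σ₂ k f ≡ false
Σ₂-zero zero    f≗0 = refl
Σ₂-zero (suc k) f≗0 = cong₂ _xor_ (f≗0 zero) (Σ₂-zero k (f≗0 ∘ suc))

Σ₂-indicator : ∀ K (f : Fin K → Bool) m → Σ₂ K (λ l → f l ∧ does (l ≟ᶠ m)) ≡ f m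
Σ₂-indicator (suc K) f zero    = trans (cong₂ _xor_ (∧-identityʳ (f zero)) (Σ₂-zero K (λ l → ∧-zeroʳ (f (suc l)))))
                                       (xor-identityʳ (f zero))
Σ₂-indicator (suc K) f (suc m) = trans (cong (_xor Σ₂ K (λ l → f (suc l) ∧ does (l ≟ᶠ m))) (∧-zeroʳ (f zero)))
                                       (Σ₂-indicator K (f ∘ suc) m)

Σ₂≡⨁ : ∀ K (f : ℕ → Bool) → Σ₂ K (f ∘ toℕ) ≡ ⨁ K f
Σ₂≡⨁ zero    f = refl
Σ₂≡⨁ (suc K) f = cong (f 0 xor_) (Σ₂≡⨁ K (f ∘ suc))

⨁-cong : ∀ K {f g : ℕ → Bool} → (∀ k → k < K → f k ≡ g k) → ⨁ K f ≡ ⨁ K g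
⨁-cong zero    f≗g = refl
⨁-cong (suc K) f≗g = cong₂ _xor_ (f≗g 0 z<s) (⨁-cong K (λ k k<K → f≗g (suc k) (s<s k<K)))

⨁-zero : ∀ K {f : ℕ → Bool} → (∀ k → k < K → f k ≡ false) → ⨁ K f ≡ false
⨁-zero K f≗0 = trans (⨁-cong K f≗0) (⨁-const-false K)
  where
  ⨁-const-false : ∀ K → ⨁ K (λ _ → false) ≡ false
  ⨁-const-false zero    = refl
  ⨁-const-false (suc K) = ⨁-const-false K

⨁-snoc : ∀ K (f : ℕ → Bool) → ⨁ (suc K) f ≡ ⨁ K f xor f K
⨁-snoc zero    f = xor-comm (f 0) false
⨁-snoc (suc K) f = begin
  f 0 xor ⨁ (suc K) (f ∘ suc)        ≡⟨ cong (f 0 xor_) (⨁-snoc K (f ∘ suc)) ⟩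
  f 0 xor (⨁ K (f ∘ suc) xor f (suc K)) ≡⟨ xor-assoc (f 0) _ _ ⟨
  (f 0 xor ⨁ K (f ∘ suc)) xor f (suc K) ∎
  where open ≡-Reasoning

⨁-single : ∀ K (f : ℕ → Bool) {i} → i < K → (∀ k → k < K → k ≢ i → f k ≡ false) → ⨁ K f ≡ f i
⨁-single (suc K) f {zero} _ others = begin
  f 0 xor ⨁ K (f ∘ suc) ≡⟨ cong (f 0 xor_) (⨁-zero K (λ k k<K → others (suc k) (s<s k<K) λ ())) ⟩
  f 0 xor false         ≡⟨ xor-identityʳ (f 0) ⟩
  f 0                   ∎
  where open ≡-Reasoning
⨁-single (suc K) f {suc i} (s<s i<K) others =
  cong₂ _xor_ (others 0 z<s λ ()) (⨁-single K (f ∘ suc) i<K λ k k<K k≢i → others (suc k) (s<s k<K) (k≢i ∘ suc-injective))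

⨁-indicator : ∀ K (f : ℕ → Bool) {m} → m < K → ⨁ K (λ l → does (l ≟ m) ∧ f l) ≡ f m
⨁-indicator K f {m} m<K = trans (⨁-single K _ m<K (λ l _ l≢m → cong (_∧ f l) (dec-false (l ≟ m) l≢m)))
                                (cong (_∧ f m) (dec-true (m ≟ m) refl))

⨁-xor : ∀ K (f g : ℕ → Bool) → ⨁ K (λ k → f k xor g k) ≡ ⨁ K f xor ⨁ K g
⨁-xor zero    f g = refl
⨁-xor (suc K) f g = trans (cong ((f 0 xor g 0) xor_) (⨁-xor K (f ∘ suc) (g ∘ suc)))
                          (interchange (f 0) (g 0) (⨁ K (f ∘ suc)) (⨁ K (g ∘ suc)))

⨁-∧ˡ : ∀ K x (f : ℕ → Bool) → ⨁ K (λ k → x ∧ f k) ≡ x ∧ ⨁ K f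
⨁-∧ˡ zero    x f = sym (∧-zeroʳ x)
⨁-∧ˡ (suc K) x f = trans (cong ((x ∧ f 0) xor_) (⨁-∧ˡ K x (f ∘ suc))) (sym (∧-distribˡ-xor x (f 0) _))

⨁-∧ʳ : ∀ K x (f : ℕ → Bool) → ⨁ K (λ k → f k ∧ x) ≡ ⨁ K f ∧ x
⨁-∧ʳ K x f = trans (⨁-cong K (λ k _ → ∧-comm (f k) x)) (trans (⨁-∧ˡ K x f) (∧-comm x _))

⨁-swap : ∀ K L (f : ℕ → ℕ → Bool) → ⨁ K (λ a → ⨁ L (f a)) ≡ ⨁ L (λ b → ⨁ K (λ a → f a b))
⨁-swap zero    L f = sym (⨁-zero L (λ _ _ → refl))
⨁-swap (suc K) L f = trans (cong (⨁ L (f 0) xor_) (⨁-swap K L (f ∘ suc)))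
                           (sym (⨁-xor L (f 0) (λ b → ⨁ K (λ a → f (suc a) b))))

⨁-reverse : ∀ K (f : ℕ → Bool) → ⨁ K (λ k → f (K ∸ 1 ∸ k)) ≡ ⨁ K f
⨁-reverse zero    f = refl
⨁-reverse (suc K) f = begin
  f K xor ⨁ K (λ k → f (K ∸ suc k))  ≡⟨ cong (f K xor_) (⨁-cong K (λ k _ → cong f (∸-+-assoc K 1 k))) ⟨
  f K xor ⨁ K (λ k → f (K ∸ 1 ∸ k)) ≡⟨ cong (f K xor_) (⨁-reverse K f) ⟩
  f K xor ⨁ K f                     ≡⟨ xor-comm (f K) _ ⟩
  ⨁ K f xor f K                     ≡⟨ ⨁-snoc K f ⟨
  ⨁ (suc K) f                       ∎
  where open ≡-Reasoning

<⇒≤∸1 : ∀ {k K} → k < K → k ≤ K ∸ 1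
<⇒≤∸1 (s≤s k≤K) = k≤K

∸1∸-< : ∀ {K l} → l < K → K ∸ 1 ∸ l < K
∸1∸-< {suc K} {l} _ = s≤s (m∸n≤m K l)

∸1< : ∀ {K} → 1 ≤ K → K ∸ 1 < K
∸1< = ∸1∸-< {l = 0}

⨁-antidiagonal : ∀ K (h : ℕ → Bool) {l} → l < K → ⨁ K (λ k → h k ∧ does (k + l ≟ K ∸ 1)) ≡ h (K ∸ 1 ∸ l)
⨁-antidiagonal K h {l} l<K = begin
  ⨁ K (λ k → h k ∧ does (k + l ≟ K ∸ 1)) ≡⟨ ⨁-single K _ (∸1∸-< l<K) off-antidiagonal ⟩
  h i ∧ does (i + l ≟ K ∸ 1)            ≡⟨ cong (h i ∧_) (dec-true (i + l ≟ K ∸ 1) (m∸n+n≡m (<⇒≤∸1 l<K))) ⟩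
  h i ∧ true                            ≡⟨ ∧-identityʳ (h i) ⟩
  h i                                   ∎
  where
  open ≡-Reasoning
  i = K ∸ 1 ∸ l
  off-antidiagonal : ∀ k → k < K → k ≢ i → h k ∧ does (k + l ≟ K ∸ 1) ≡ false
  off-antidiagonal k _ k≢i = trans (cong (h k ∧_) (dec-false (k + l ≟ K ∸ 1) λ k+l≡ →
    k≢i (trans (sym (m+n∸n≡m k l)) (cong (_∸ l) k+l≡)))) (∧-zeroʳ (h k))

-- Over Z₂ the matrix M of the statement is the antidiagonal 2n × 2n matrix (since −J = J),
-- so the form xᵀ M y on columns x, y is ω (n + n) x y.
ω : ℕ → (ℕ → Bool) → (ℕ → Bool) → Bool
ω K x y = ⨁ K (λ l → x (K ∸ 1 ∸ l) ∧ y l)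

ω-cong : ∀ K {x x′ y y′ : ℕ → Bool} → (∀ a → a < K → x a ≡ x′ a) → (∀ a → a < K → y a ≡ y′ a) →
         ω K x y ≡ ω K x′ y′
ω-cong K x≗x′ y≗y′ = ⨁-cong K (λ l l<K → cong₂ _∧_ (x≗x′ _ (∸1∸-< l<K)) (y≗y′ l l<K))

ω-sym : ∀ K x y → ω K x y ≡ ω K y x
ω-sym K x y = begin
  ω K x y
    ≡⟨ ⨁-reverse K _ ⟨
  ⨁ K (λ k → x (K ∸ 1 ∸ (K ∸ 1 ∸ k)) ∧ y (K ∸ 1 ∸ k))
    ≡⟨ ⨁-cong K (λ k k<K → cong (_∧ y (K ∸ 1 ∸ k)) (cong x (m∸[m∸n]≡n (<⇒≤∸1 k<K)))) ⟩
  ⨁ K (λ k → x k ∧ y (K ∸ 1 ∸ k))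
    ≡⟨ ⨁-cong K (λ k _ → ∧-comm (x k) _) ⟩
  ω K y x ∎
  where open ≡-Reasoning

ω-zeroˡ : ∀ K y → ω K (λ _ → false) y ≡ false
ω-zeroˡ K y = ⨁-zero K (λ _ _ → refl)

ω-zeroʳ : ∀ K x → ω K x (λ _ → false) ≡ false
ω-zeroʳ K x = trans (ω-sym K x _) (ω-zeroˡ K x)

ω-peel : ∀ K x y → ω (suc (suc K)) x y ≡ (x (suc K) ∧ y 0) xor (ω K (x ∘ suc) (y ∘ suc) xor (x 0 ∧ y (suc K)))
ω-peel K x y = cong ((x (suc K) ∧ y 0) xor_) $ begin
  ⨁ (suc K) (λ l → x (K ∸ l) ∧ y (suc l))
    ≡⟨ ⨁-snoc K _ ⟩
  ⨁ K (λ l → x (K ∸ l) ∧ y (suc l)) xor (x (K ∸ K) ∧ y (suc K))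
    ≡⟨ cong₂ _xor_ (⨁-cong K inner) (cong (λ t → x t ∧ y (suc K)) (n∸n≡0 K)) ⟩
  ω K (x ∘ suc) (y ∘ suc) xor (x 0 ∧ y (suc K)) ∎
  where
  open ≡-Reasoning
  inner : ∀ l → l < K → x (K ∸ l) ∧ y (suc l) ≡ x (suc (K ∸ 1 ∸ l)) ∧ y (suc l)
  inner l (s≤s l≤K-1) = cong (λ t → x t ∧ y (suc l)) (+-∸-assoc 1 l≤K-1)

ω-alternating : ∀ n x → ω (n + n) x x ≡ false
ω-alternating zero    x = refl
ω-alternating (suc n) x rewrite +-suc n n = begin
  ω (suc (suc (n + n))) x x
    ≡⟨ ω-peel (n + n) x x ⟩
  (a ∧ b) xor (ω (n + n) (x ∘ suc) (x ∘ suc) xor (b ∧ a))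
    ≡⟨ cong (λ t → (a ∧ b) xor (t xor (b ∧ a))) (ω-alternating n (x ∘ suc)) ⟩
  (a ∧ b) xor (b ∧ a)
    ≡⟨ cong ((a ∧ b) xor_) (∧-comm b a) ⟩
  (a ∧ b) xor (a ∧ b)
    ≡⟨ xor-same (a ∧ b) ⟩
  false ∎
  where
  open ≡-Reasoning
  a = x (suc (n + n))
  b = x 0

lookupOr : ∀ {A : Set} {k} → A → Vec A k → ℕ → A
lookupOr d []       _       = d
lookupOr d (x ∷ xs) zero    = x
lookupOr d (x ∷ xs) (suc m) = lookupOr d xs m

lookupOr-toℕ : ∀ {A : Set} {k} d (xs : Vec A k) (i : Fin k) → lookupOr d xs (toℕ i) ≡ lookup xs i
lookupOr-toℕ d (x ∷ xs) zero    = refl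
lookupOr-toℕ d (x ∷ xs) (suc i) = lookupOr-toℕ d xs i

lookupOr-tabulate : ∀ {A : Set} {K} d (h : ℕ → A) {a} → a < K → lookupOr d (tabulate {n = K} (h ∘ toℕ)) a ≡ h a
lookupOr-tabulate {K = suc K} d h {zero}  _         = refl
lookupOr-tabulate {K = suc K} d h {suc a} (s<s a<K) = lookupOr-tabulate d (h ∘ suc) a<K

-- ℕ indices make the reversal a ↦ K ∸ 1 ∸ a of the symplectic form plain arithmetic.  Indices out
-- of range give the junk entry false, so lemmas about ⟦_,_⟧ carry bounds.
_⟦_,_⟧ : ∀ {k} → Mat k → ℕ → ℕ → Bool
A ⟦ a , b ⟧ = lookupOr false (lookupOr (replicate _ false) A a) b

⟦⟧-toℕ : ∀ {k} (A : Mat k) i j → A ⟦ toℕ i , toℕ j ⟧ ≡ A [ i , j ]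
⟦⟧-toℕ A i j = trans (cong (λ r → lookupOr false r (toℕ j)) (lookupOr-toℕ _ A i)) (lookupOr-toℕ false (lookup A i) j)

mkMat-[] : ∀ {k} (f : Fin k → Fin k → Bool) i j → mkMat f [ i , j ] ≡ f i j
mkMat-[] f i j = trans (cong (λ r → lookup r j) (lookup∘tabulate _ i)) (lookup∘tabulate _ j)

fromFin₂ : ∀ {K} (P : ℕ → ℕ → Set) → (∀ (i j : Fin K) → P (toℕ i) (toℕ j)) → ∀ a b → a < K → b < K → P a b
fromFin₂ P P-fin a b a<K b<K = subst₂ P (toℕ-fromℕ< a<K) (toℕ-fromℕ< b<K) (P-fin _ _)

tabulateℕ : ∀ K → (ℕ → ℕ → Bool) → Mat K
tabulateℕ K F = mkMat (λ i j → F (toℕ i) (toℕ j))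

tabulateℕ-⟦⟧ : ∀ K F a b → a < K → b < K → tabulateℕ K F ⟦ a , b ⟧ ≡ F a b
tabulateℕ-⟦⟧ K F = fromFin₂ (λ a b → tabulateℕ K F ⟦ a , b ⟧ ≡ F a b)
  (λ i j → trans (⟦⟧-toℕ (tabulateℕ K F) i j) (mkMat-[] _ i j))

Mat-ext : ∀ {k} {A B : Mat k} → (∀ i j → A [ i , j ] ≡ B [ i , j ]) → A ≡ B
Mat-ext {A = A} {B} A≗B = begin
  A                                            ≡⟨ tabulate∘lookup A ⟨
  tabulate (λ i → lookup A i)                  ≡⟨ tabulate-cong row ⟩
  tabulate (λ i → lookup B i)                  ≡⟨ tabulate∘lookup B ⟩
  B                                            ∎
  where
  open ≡-Reasoning
  row : ∀ i → lookup A i ≡ lookup B i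
  row i = trans (sym (tabulate∘lookup (lookup A i)))
                (trans (tabulate-cong (A≗B i)) (tabulate∘lookup (lookup B i)))

Mat-extℕ : ∀ {K} {A B : Mat K} → (∀ a b → a < K → b < K → A ⟦ a , b ⟧ ≡ B ⟦ a , b ⟧) → A ≡ B
Mat-extℕ {A = A} {B} A≗B = Mat-ext λ i j →
  trans (sym (⟦⟧-toℕ A i j)) (trans (A≗B _ _ (toℕ<n i) (toℕ<n j)) (⟦⟧-toℕ B i j))

*ᴹ-⟦⟧ : ∀ {K} (A B : Mat K) a b → a < K → b < K → (A *ᴹ B) ⟦ a , b ⟧ ≡ ⨁ K (λ l → A ⟦ a , l ⟧ ∧ B ⟦ l , b ⟧)
*ᴹ-⟦⟧ {K} A B = fromFin₂ (λ a b → (A *ᴹ B) ⟦ a , b ⟧ ≡ ⨁ K (λ l → A ⟦ a , l ⟧ ∧ B ⟦ l , b ⟧)) λ i j → begin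
  (A *ᴹ B) ⟦ toℕ i , toℕ j ⟧
    ≡⟨ ⟦⟧-toℕ (A *ᴹ B) i j ⟩
  (A *ᴹ B) [ i , j ]
    ≡⟨ mkMat-[] _ i j ⟩
  Σ₂ K (λ l → A [ i , l ] ∧ B [ l , j ])
    ≡⟨ Σ₂-cong K (λ l → sym (cong₂ _∧_ (⟦⟧-toℕ A i l) (⟦⟧-toℕ B l j))) ⟩
  Σ₂ K (λ l → A ⟦ toℕ i , toℕ l ⟧ ∧ B ⟦ toℕ l , toℕ j ⟧)
    ≡⟨ Σ₂≡⨁ K _ ⟩
  ⨁ K (λ l → A ⟦ toℕ i , l ⟧ ∧ B ⟦ l , toℕ j ⟧) ∎
  where open ≡-Reasoning

*ᴹ-assoc : ∀ {K} (A B C : Mat K) → (A *ᴹ B) *ᴹ C ≡ A *ᴹ (B *ᴹ C)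
*ᴹ-assoc {K} A B C = Mat-extℕ λ a b a<K b<K → begin
  ((A *ᴹ B) *ᴹ C) ⟦ a , b ⟧
    ≡⟨ *ᴹ-⟦⟧ (A *ᴹ B) C a b a<K b<K ⟩
  ⨁ K (λ l → (A *ᴹ B) ⟦ a , l ⟧ ∧ C ⟦ l , b ⟧)
    ≡⟨ ⨁-cong K (λ l l<K → cong (_∧ C ⟦ l , b ⟧) (*ᴹ-⟦⟧ A B a l a<K l<K)) ⟩
  ⨁ K (λ l → ⨁ K (λ k → A ⟦ a , k ⟧ ∧ B ⟦ k , l ⟧) ∧ C ⟦ l , b ⟧)
    ≡⟨ ⨁-cong K (λ l _ → sym (⨁-∧ʳ K (C ⟦ l , b ⟧) _)) ⟩
  ⨁ K (λ l → ⨁ K (λ k → (A ⟦ a , k ⟧ ∧ B ⟦ k , l ⟧) ∧ C ⟦ l , b ⟧))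
    ≡⟨ ⨁-swap K K _ ⟩
  ⨁ K (λ k → ⨁ K (λ l → (A ⟦ a , k ⟧ ∧ B ⟦ k , l ⟧) ∧ C ⟦ l , b ⟧))
    ≡⟨ ⨁-cong K (λ k _ → ⨁-cong K (λ l _ → ∧-assoc (A ⟦ a , k ⟧) _ _)) ⟩
  ⨁ K (λ k → ⨁ K (λ l → A ⟦ a , k ⟧ ∧ (B ⟦ k , l ⟧ ∧ C ⟦ l , b ⟧)))
    ≡⟨ ⨁-cong K (λ k _ → ⨁-∧ˡ K (A ⟦ a , k ⟧) _) ⟩
  ⨁ K (λ k → A ⟦ a , k ⟧ ∧ ⨁ K (λ l → B ⟦ k , l ⟧ ∧ C ⟦ l , b ⟧))
    ≡⟨ ⨁-cong K (λ k k<K → cong (A ⟦ a , k ⟧ ∧_) (*ᴹ-⟦⟧ B C k b k<K b<K)) ⟨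
  ⨁ K (λ k → A ⟦ a , k ⟧ ∧ (B *ᴹ C) ⟦ k , b ⟧)
    ≡⟨ *ᴹ-⟦⟧ A (B *ᴹ C) a b a<K b<K ⟨
  (A *ᴹ (B *ᴹ C)) ⟦ a , b ⟧ ∎
  where open ≡-Reasoning

col : (ℕ → ℕ → Bool) → ℕ → ℕ → Bool
col g j a = g a j

Symplecticℕ : ℕ → (ℕ → ℕ → Bool) → Set
Symplecticℕ K g = ∀ i j → i < K → j < K → ω K (col g i) (col g j) ≡ does (i + j ≟ K ∸ 1)

toℕ-splitAt-inj₁ : ∀ n {i : Fin (n + n)} {a} → splitAt n i ≡ inj₁ a → toℕ i ≡ toℕ a
toℕ-splitAt-inj₁ n {a = a} eq = trans (cong toℕ (sym (splitAt⁻¹-↑ˡ eq))) (toℕ-↑ˡ a n)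

toℕ-splitAt-inj₂ : ∀ n {i : Fin (n + n)} {b} → splitAt n i ≡ inj₂ b → toℕ i ≡ n + toℕ b
toℕ-splitAt-inj₂ n {b = b} eq = trans (cong toℕ (sym (splitAt⁻¹-↑ʳ eq))) (toℕ-↑ʳ n b)

+-antidiagonal : ∀ n s → 1 ≤ n → (s ≡ n ∸ 1) ⇔ (n + s ≡ n + n ∸ 1)
+-antidiagonal n s 1≤n = mk⇔ (λ s≡ → trans (cong (λ t → n + t) s≡) (sym (+-∸-assoc n 1≤n)))
                             (λ n+s≡ → +-cancelˡ-≡ n _ _ (trans n+s≡ (+-∸-assoc n 1≤n)))

<-antidiagonal : ∀ {n x y} → x < n → y < n → x + y < n + n ∸ 1
<-antidiagonal {n} {x} {y} x<n y<n = begin-strict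
  x + y           <⟨ +-monoʳ-< x y<n ⟩
  x + n           ≤⟨ +-monoˡ-≤ n (<⇒≤∸1 x<n) ⟩
  n ∸ 1 + n       ≡⟨ +-comm (n ∸ 1) n ⟩
  n + (n ∸ 1)     ≡⟨ +-∸-assoc n (≤-trans (s≤s z≤n) x<n) ⟨
  n + n ∸ 1       ∎
  where open ≤-Reasoning

>-antidiagonal : ∀ n x y → 1 ≤ n → n + n ∸ 1 < (n + x) + (n + y)
>-antidiagonal n x y 1≤n = begin-strict
  n + n ∸ 1       <⟨ ∸-monoʳ-< {o = 0} z<s (≤-trans 1≤n (m≤m+n n n)) ⟩
  n + n           ≤⟨ +-mono-≤ (m≤m+n n x) (m≤m+n n y) ⟩
  (n + x) + (n + y) ∎
  where open ≤-Reasoning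

Mm-[] : ∀ n (i j : Fin (n + n)) → Mm n [ i , j ] ≡ does (toℕ i + toℕ j ≟ n + n ∸ 1)
Mm-[] n i j rewrite (Mm n [ i , j ] ≡ _ ∋ mkMat-[] _ i j) with splitAt n i in i≡ | splitAt n j in j≡
... | inj₁ a | inj₂ b rewrite (Jm n [ a , b ] ≡ _ ∋ mkMat-[] _ a b)
                            | toℕ-splitAt-inj₁ n i≡ | toℕ-splitAt-inj₂ n j≡ =
  trans (does-⇔ (+-antidiagonal n (toℕ a + toℕ b) (≤-trans (s≤s z≤n) (toℕ<n a))) (_ ≟ _) (_ ≟ _))
        (cong (λ s → does (s ≟ n + n ∸ 1)) (sym (x∙yz≈y∙xz (toℕ a) n (toℕ b))))
... | inj₂ a | inj₁ b rewrite (Jm n [ a , b ] ≡ _ ∋ mkMat-[] _ a b)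
                            | toℕ-splitAt-inj₂ n i≡ | toℕ-splitAt-inj₁ n j≡ =
  trans (does-⇔ (+-antidiagonal n (toℕ a + toℕ b) (≤-trans (s≤s z≤n) (toℕ<n a))) (_ ≟ _) (_ ≟ _))
        (cong (λ s → does (s ≟ n + n ∸ 1)) (sym (+-assoc n (toℕ a) (toℕ b))))
... | inj₁ a | inj₁ b rewrite toℕ-splitAt-inj₁ n i≡ | toℕ-splitAt-inj₁ n j≡ =
  sym (dec-false (_ ≟ _) (<⇒≢ (<-antidiagonal (toℕ<n a) (toℕ<n b))))
... | inj₂ a | inj₂ b rewrite toℕ-splitAt-inj₂ n i≡ | toℕ-splitAt-inj₂ n j≡ =
  sym (dec-false (_ ≟ _) (>⇒≢ (>-antidiagonal n (toℕ a) (toℕ b) (≤-trans (s≤s z≤n) (toℕ<n a)))))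

transpose*Mm-[] : ∀ n (A : Mat (n + n)) i l → (transpose A *ᴹ Mm n) [ i , l ] ≡ A ⟦ n + n ∸ 1 ∸ toℕ l , toℕ i ⟧
transpose*Mm-[] n A i l = begin
  (transpose A *ᴹ Mm n) [ i , l ]                                 ≡⟨ mkMat-[] _ i l ⟩
  Σ₂ (n + n) (λ k → transpose A [ i , k ] ∧ Mm n [ k , l ])       ≡⟨ Σ₂-cong (n + n) entries ⟩
  Σ₂ (n + n) (λ k → A ⟦ toℕ k , toℕ i ⟧ ∧ does (toℕ k + toℕ l ≟ n + n ∸ 1)) ≡⟨ Σ₂≡⨁ (n + n) _ ⟩
  ⨁ (n + n) (λ k → A ⟦ k , toℕ i ⟧ ∧ does (k + toℕ l ≟ n + n ∸ 1)) ≡⟨ ⨁-antidiagonal (n + n) _ (toℕ<n l) ⟩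
  A ⟦ n + n ∸ 1 ∸ toℕ l , toℕ i ⟧                                  ∎
  where
  open ≡-Reasoning
  entries : ∀ k → transpose A [ i , k ] ∧ Mm n [ k , l ] ≡ A ⟦ toℕ k , toℕ i ⟧ ∧ does (toℕ k + toℕ l ≟ n + n ∸ 1)
  entries k = cong₂ _∧_ (trans (mkMat-[] _ i k) (sym (⟦⟧-toℕ A k i))) (Mm-[] n k l)

symplecticForm-[] : ∀ n (A : Mat (n + n)) i j →
  (transpose A *ᴹ Mm n *ᴹ A) [ i , j ] ≡ ω (n + n) (col (A ⟦_,_⟧) (toℕ i)) (col (A ⟦_,_⟧) (toℕ j))
symplecticForm-[] n A i j = begin
  (transpose A *ᴹ Mm n *ᴹ A) [ i , j ]
    ≡⟨ mkMat-[] _ i j ⟩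
  Σ₂ (n + n) (λ l → (transpose A *ᴹ Mm n) [ i , l ] ∧ A [ l , j ])
    ≡⟨ Σ₂-cong (n + n) (λ l → cong₂ _∧_ (transpose*Mm-[] n A i l) (sym (⟦⟧-toℕ A l j))) ⟩
  Σ₂ (n + n) (λ l → A ⟦ n + n ∸ 1 ∸ toℕ l , toℕ i ⟧ ∧ A ⟦ toℕ l , toℕ j ⟧)
    ≡⟨ Σ₂≡⨁ (n + n) _ ⟩
  ω (n + n) (col (A ⟦_,_⟧) (toℕ i)) (col (A ⟦_,_⟧) (toℕ j)) ∎
  where open ≡-Reasoning

symplectic⇒Symplecticℕ : ∀ n (A : Mat (n + n)) → transpose A *ᴹ Mm n *ᴹ A ≡ Mm n → Symplecticℕ (n + n) (A ⟦_,_⟧)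
symplectic⇒Symplecticℕ n A AᵀMA≡M =
  fromFin₂ (λ i j → ω (n + n) (col (A ⟦_,_⟧) i) (col (A ⟦_,_⟧) j) ≡ does (i + j ≟ n + n ∸ 1))
  (λ i j → trans (sym (symplecticForm-[] n A i j)) (trans (cong (_[ i , j ]) AᵀMA≡M) (Mm-[] n i j)))

Symplecticℕ⇒symplectic : ∀ n (A : Mat (n + n)) → Symplecticℕ (n + n) (A ⟦_,_⟧) → transpose A *ᴹ Mm n *ᴹ A ≡ Mm n
Symplecticℕ⇒symplectic n A sp = Mat-ext λ i j →
  trans (symplecticForm-[] n A i j) (trans (sp (toℕ i) (toℕ j) (toℕ<n i) (toℕ<n j)) (sym (Mm-[] n i j)))

UpperTriℕ : ℕ → (ℕ → ℕ → Bool) → Set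
UpperTriℕ K g = ∀ i j → j < i → i < K → g i j ≡ false

UpperTri⇒UpperTriℕ : ∀ {K} (A : Mat K) → UpperTri A → UpperTriℕ K (A ⟦_,_⟧)
UpperTri⇒UpperTriℕ {K} A ut i j j<i i<K = fromFin₂ (λ a b → b < a → A ⟦ a , b ⟧ ≡ false)
  (λ a b b<a → trans (⟦⟧-toℕ A a b) (ut a b b<a)) i j i<K (<-trans j<i i<K) j<i

UpperTriℕ⇒UpperTri : ∀ {K} (A : Mat K) → UpperTriℕ K (A ⟦_,_⟧) → UpperTri A
UpperTriℕ⇒UpperTri A ut i j j<i = trans (sym (⟦⟧-toℕ A i j)) (ut _ _ j<i (toℕ<n i))

_≈[_]_ : (ℕ → ℕ → Bool) → ℕ → (ℕ → ℕ → Bool) → Set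
g ≈[ K ] h = ∀ a b → a < K → b < K → g a b ≡ h a b

UpperTriℕ-resp : ∀ {K g h} → g ≈[ K ] h → UpperTriℕ K g → UpperTriℕ K h
UpperTriℕ-resp g≈h ut i j j<i i<K = trans (sym (g≈h i j i<K (<-trans j<i i<K))) (ut i j j<i i<K)

Symplecticℕ-resp : ∀ {K g h} → g ≈[ K ] h → Symplecticℕ K g → Symplecticℕ K h
Symplecticℕ-resp {K} g≈h sp i j i<K j<K =
  trans (sym (ω-cong K (λ a a<K → g≈h a i a<K i<K) (λ a a<K → g≈h a j a<K j<K))) (sp i j i<K j<K)

minor : ∀ {k} → Mat (suc k) → Fin (suc k) → Mat k
minor A j = mkMat (λ r c → A [ suc r , punchIn j c ])

minor-[] : ∀ {k} (A : Mat (suc k)) j r c → minor A j [ r , c ] ≡ A [ suc r , punchIn j c ]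
minor-[] A j = mkMat-[] (λ r c → A [ suc r , punchIn j c ])

det-zeroColumn : ∀ k (A : Mat k) c → (∀ r → A [ r , c ] ≡ false) → det k A ≡ false
det-zeroColumn (suc k) A c column≡0 = Σ₂-zero (suc k) expansion
  where
  expansion : ∀ j → A [ zero , j ] ∧ det k (minor A j) ≡ false
  expansion j with j ≟ᶠ c
  ... | yes refl = cong (_∧ det k (minor A j)) (column≡0 zero)
  ... | no j≢c = trans (cong (A [ zero , j ] ∧_) (det-zeroColumn k (minor A j) (punchOut j≢c) λ r →
    trans (minor-[] A j r _) (trans (cong (λ t → A [ suc r , t ]) (punchIn-punchOut j≢c)) (column≡0 (suc r)))))
    (∧-zeroʳ _)

det-minor-suc : ∀ k (A : Mat (suc k)) → UpperTri A → ∀ j → det k (minor A (suc j)) ≡ false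
det-minor-suc (suc k) A ut j = det-zeroColumn (suc k) (minor A (suc j)) zero
  (λ r → trans (minor-[] A (suc j) r zero) (ut (suc r) zero z<s))

det-unitriangular : ∀ k (A : Mat k) → UpperTri A → (∀ i → A [ i , i ] ≡ true) → det k A ≡ true
det-unitriangular zero    A _  _    = refl
det-unitriangular (suc k) A ut diag = cong₂ _xor_ first-term (Σ₂-zero k other-terms)
  where
  first-term : A [ zero , zero ] ∧ det k (minor A zero) ≡ true
  first-term = cong₂ _∧_ (diag zero) (det-unitriangular k (minor A zero)
    (λ i j j<i → trans (minor-[] A zero i j) (ut (suc i) (suc j) (s≤s j<i)))
    (λ i → trans (minor-[] A zero i i) (diag (suc i))))
  other-terms : ∀ j → A [ zero , suc j ] ∧ det k (minor A (suc j)) ≡ false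
  other-terms j = trans (cong (A [ zero , suc j ] ∧_) (det-minor-suc k A ut j)) (∧-zeroʳ _)

-- The form pairs column i only with column K ∸ 1 ∸ i, and for an upper triangular matrix
-- that pairing reduces to the product of the two diagonal entries.
upperTriSymplectic-diagonal : ∀ K g → UpperTriℕ K g → Symplecticℕ K g → ∀ i → i < K → g i i ≡ true
upperTriSymplectic-diagonal K g ut sp i i<K = ∧-true-left $ begin
  g i i ∧ g i′ i′                              ≡⟨ cong (λ t → g t i ∧ g i′ i′) (m∸[m∸n]≡n i≤m) ⟨
  g (m ∸ i′) i ∧ g i′ i′                       ≡⟨ ⨁-single K (λ l → g (m ∸ l) i ∧ g l i′) (∸1∸-< i<K) others ⟨
  ω K (col g i) (col g i′)                     ≡⟨ sp i i′ i<K (∸1∸-< i<K) ⟩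
  does (i + i′ ≟ m)                            ≡⟨ dec-true (i + i′ ≟ m) (m+[n∸m]≡n i≤m) ⟩
  true                                         ∎
  where
  open ≡-Reasoning
  m = K ∸ 1
  i≤m = <⇒≤∸1 i<K
  i′ = m ∸ i
  ∧-true-left : ∀ {x y} → x ∧ y ≡ true → x ≡ true
  ∧-true-left {true} _ = refl
  others : ∀ l → l < K → l ≢ i′ → g (m ∸ l) i ∧ g l i′ ≡ false
  others l l<K l≢i′ with <-cmp l i′
  ... | tri< l<i′ _ _ = cong (_∧ g l i′) (ut (m ∸ l) i
          (subst (_< m ∸ l) (m∸[m∸n]≡n i≤m) (∸-monoʳ-< l<i′ (m∸n≤m m i))) (∸1∸-< l<K))
  ... | tri≈ _ l≡i′ _ = ⊥-elim (l≢i′ l≡i′)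
  ... | tri> _ _ l>i′ = trans (cong (g (m ∸ l) i ∧_) (ut l i′ l>i′ l<K)) (∧-zeroʳ _)

InBplus⇒ℕ : ∀ n B → InBplus n B → UpperTriℕ (n + n) (B ⟦_,_⟧) × Symplecticℕ (n + n) (B ⟦_,_⟧)
InBplus⇒ℕ n B (ut , _ , sp) = UpperTri⇒UpperTriℕ B ut , symplectic⇒Symplecticℕ n B sp

ℕ⇒InBplus : ∀ n B → UpperTriℕ (n + n) (B ⟦_,_⟧) → Symplecticℕ (n + n) (B ⟦_,_⟧) → InBplus n B
ℕ⇒InBplus n B ut sp = UpperTriℕ⇒UpperTri B ut , det-unitriangular (n + n) B (UpperTriℕ⇒UpperTri B ut) diagonal
                                             , Symplecticℕ⇒symplectic n B sp
  where
  diagonal : ∀ i → B [ i , i ] ≡ true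
  diagonal i = trans (sym (⟦⟧-toℕ B i i)) (upperTriSymplectic-diagonal (n + n) _ ut sp (toℕ i) (toℕ<n i))

-- Bordering: the recursive structure of 𝔹_C^+

data Position (K : ℕ) : ℕ → Set where
  first : Position K 0
  inner : ∀ {i} → i < K → Position K (suc i)
  last  : Position K (suc K)

position : ∀ K {i} → i < suc (suc K) → Position K i
position K {zero}  _         = first
position K {suc i} (s≤s (s≤s i≤K)) with m≤n⇒m<n∨m≡n i≤K
... | inj₁ i<K  = inner i<K
... | inj₂ refl = last

<⇒suc<2+ : ∀ {a K} → a < K → suc a < suc (suc K)
<⇒suc<2+ {K = K} a<K = s<s (<-trans a<K (n<1+n K))

if-<ᵇ : ∀ {A : Set} {j K} {x y : A} → j < K → (if j <ᵇ K then x else y) ≡ x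
if-<ᵇ {j = zero}  {suc K} _         = refl
if-<ᵇ {j = suc j} {suc K} (s<s j<K) = if-<ᵇ {j = j} j<K

if-<ᵇ-refl : ∀ {A : Set} K {x y : A} → (if K <ᵇ K then x else y) ≡ y
if-<ᵇ-refl zero    = refl
if-<ᵇ-refl (suc K) = if-<ᵇ-refl K

bordered : ℕ → Bool → (ℕ → Bool) → Bool → ℕ → Bool
bordered K t v b zero    = t
bordered K t v b (suc a) = if a <ᵇ K then v a else b

pick : ∀ {K a} → Position K a → Bool → (ℕ → Bool) → Bool → Bool
pick first             t v b = t
pick (inner {i = a} _) t v b = v a
pick last              t v b = b

bordered-pick : ∀ K t v b {a} (p : Position K a) → bordered K t v b a ≡ pick p t v b
bordered-pick K t v b first       = refl
bordered-pick K t v b (inner a<K) = if-<ᵇ a<K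
bordered-pick K t v b last        = if-<ᵇ-refl K

bordered-inner : ∀ K t v b {a} → a < K → bordered K t v b (suc a) ≡ v a
bordered-inner K t v b a<K = bordered-pick K t v b (inner a<K)

bordered-last : ∀ K t v b → bordered K t v b (suc K) ≡ b
bordered-last K t v b = bordered-pick K t v b last

suc+suc-antidiagonal : ∀ {K} i j → i < K → does (suc i + suc j ≟ suc K) ≡ does (i + j ≟ K ∸ 1)
suc+suc-antidiagonal {suc K} i j _ = does-⇔ (mk⇔ (λ eq → suc-injective (trans (sym (+-suc i j)) (suc-injective eq)))
                                                 (λ eq → cong suc (trans (+-suc i j) (cong suc eq)))) (_ ≟ _) (_ ≟ _)

ω-bordered : ∀ K t v b t′ v′ b′ →
  ω (suc (suc K)) (bordered K t v b) (bordered K t′ v′ b′) ≡ (b ∧ t′) xor (ω K v v′ xor (t ∧ b′))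
ω-bordered K t v b t′ v′ b′ = trans (ω-peel K (bordered K t v b) (bordered K t′ v′ b′))
  (cong₂ _xor_ (cong (_∧ t′) (bordered-last K t v b))
               (cong₂ _xor_ (ω-cong K (λ a → bordered-inner K t v b) (λ a → bordered-inner K t′ v′ b′))
                            (cong (t ∧_) (bordered-last K t′ v′ b′))))

-- ⎡ 1  ρ   c ⎤
-- ⎢ 0  B′  s ⎥   where ρ j = ω K (col B′ j) s is the only top row making the inner columns
-- ⎣ 0  0   1 ⎦   orthogonal to the last one.
module Frame (K : ℕ) (b′ : ℕ → ℕ → Bool) (s : ℕ → Bool) (c : Bool) where

  ρ : ℕ → Bool
  ρ j = ω K (col b′ j) s

  frameColumn : ℕ → ℕ → Bool
  frameColumn zero    = bordered K true (λ _ → false) false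
  frameColumn (suc j) = if j <ᵇ K then bordered K (ρ j) (col b′ j) false else bordered K c s true

  frame : ℕ → ℕ → Bool
  frame a j = frameColumn j a

  top : ∀ {j} → Position K j → Bool
  top first             = true
  top (inner {i = j} _) = ρ j
  top last              = c

  middle : ∀ {j} → Position K j → ℕ → Bool
  middle first             = λ _ → false
  middle (inner {i = j} _) = col b′ j
  middle last              = s

  bottom : ∀ {j} → Position K j → Bool
  bottom first     = false
  bottom (inner _) = false
  bottom last      = true

  frameColumn-bordered : ∀ {j} (q : Position K j) → frameColumn j ≡ bordered K (top q) (middle q) (bottom q)
  frameColumn-bordered first       = refl
  frameColumn-bordered (inner j<K) = if-<ᵇ j<K
  frameColumn-bordered last        = if-<ᵇ-refl K

  frame-pick : ∀ {a j} (p : Position K a) (q : Position K j) → frame a j ≡ pick p (top q) (middle q) (bottom q)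
  frame-pick {a} p q = trans (cong (λ f → f a) (frameColumn-bordered q)) (bordered-pick K (top q) (middle q) (bottom q) p)

  frame-upperTri : UpperTriℕ K b′ → UpperTriℕ (suc (suc K)) frame
  frame-upperTri ut a j j<a a<K+2 = trans (frame-pick p q) (below p q j<a)
    where
    p = position K a<K+2
    q = position K (<-trans j<a a<K+2)
    below : ∀ {a j} (p : Position K a) (q : Position K j) → j < a → pick p (top q) (middle q) (bottom q) ≡ false
    below (inner a<K) first       _         = refl
    below (inner a<K) (inner j<K) (s<s j<a) = ut _ _ j<a a<K
    below (inner a<K) last        (s<s K<a) = ⊥-elim (<-asym K<a a<K)
    below last        first       _         = refl
    below last        (inner _)   _         = refl
    below last        last        K<K       = ⊥-elim (<-irrefl refl K<K)

  frame-symplectic : Symplecticℕ K b′ → ω K s s ≡ false → Symplecticℕ (suc (suc K)) frame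
  frame-symplectic sp alternating i j i<K+2 j<K+2 = begin
    ω (suc (suc K)) (frameColumn i) (frameColumn j)
      ≡⟨ cong₂ (ω (suc (suc K))) (frameColumn-bordered p) (frameColumn-bordered q) ⟩
    ω (suc (suc K)) (bordered K (top p) (middle p) (bottom p)) (bordered K (top q) (middle q) (bottom q))
      ≡⟨ ω-bordered K _ _ _ _ _ _ ⟩
    (bottom p ∧ top q) xor (ω K (middle p) (middle q) xor (top p ∧ bottom q))
      ≡⟨ pairing p q ⟩
    does (i + j ≟ suc K) ∎
    where
    open ≡-Reasoning
    p = position K i<K+2
    q = position K j<K+2
    pairing : ∀ {i j} (p : Position K i) (q : Position K j) →
      (bottom p ∧ top q) xor (ω K (middle p) (middle q) xor (top p ∧ bottom q)) ≡ does (i + j ≟ suc K)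
    pairing first first = cong (_xor false) (ω-zeroˡ K (λ _ → false))
    pairing first (inner {i = j} j<K) =
      trans (cong (_xor false) (ω-zeroˡ K (col b′ j))) (sym (dec-false (_ ≟ _) (<⇒≢ (s<s j<K))))
    pairing first last = trans (cong (_xor true) (ω-zeroˡ K s)) (sym (dec-true (suc K ≟ suc K) refl))
    pairing (inner {i = i} i<K) first = trans (cong₂ _xor_ (ω-zeroʳ K (col b′ i)) (∧-zeroʳ (ρ i)))
      (sym (dec-false (suc i + 0 ≟ suc K) (<⇒≢ (subst (_< suc K) (sym (+-identityʳ (suc i))) (s<s i<K)))))
    pairing (inner {i = i} i<K) (inner {i = j} j<K) = trans (cong₂ _xor_ (sp i j i<K j<K) (∧-zeroʳ (ρ i)))
      (trans (xor-identityʳ _) (sym (suc+suc-antidiagonal i j i<K)))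
    pairing (inner {i = i} i<K) last = trans (cong (ρ i xor_) (∧-identityʳ (ρ i)))
      (trans (xor-same (ρ i)) (sym (dec-false (_ ≟ _) (m+1+n≢n i ∘ suc-injective))))
    pairing last first = trans (cong (λ x → true xor (x xor (c ∧ false))) (ω-zeroʳ K s))
      (trans (cong (λ x → true xor (false xor x)) (∧-zeroʳ c)) (sym (dec-true (_ ≟ _) (+-identityʳ (suc K)))))
    pairing last (inner {i = j} j<K) = trans (cong₂ (λ x y → ρ j xor (x xor y)) (ω-sym K s (col b′ j)) (∧-zeroʳ c))
      (trans (cong (ρ j xor_) (xor-identityʳ (ρ j)))
             (trans (xor-same (ρ j)) (sym (dec-false (_ ≟ _) (m+1+n≢m K ∘ suc-injective)))))
    pairing last last = trans (cong₂ (λ x y → c xor (x xor y)) alternating (∧-identityʳ c))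
      (trans (xor-same c) (sym (dec-false (_ ≟ _) (m+1+n≢m K ∘ suc-injective))))

frame-cong : ∀ K {b₁ b₂ s₁ s₂} c → b₁ ≈[ K ] b₂ → (∀ a → a < K → s₁ a ≡ s₂ a) →
             Frame.frame K b₁ s₁ c ≈[ suc (suc K) ] Frame.frame K b₂ s₂ c
frame-cong K {b₁} {b₂} {s₁} {s₂} c b₁≈b₂ s₁≈s₂ a j a<K+2 j<K+2 = begin
  F₁.frame a j                                   ≡⟨ F₁.frame-pick p q ⟩
  pick p (F₁.top q) (F₁.middle q) (F₁.bottom q)  ≡⟨ same p q ⟩
  pick p (F₂.top q) (F₂.middle q) (F₂.bottom q)  ≡⟨ F₂.frame-pick p q ⟨
  F₂.frame a j                                   ∎
  where
  open ≡-Reasoning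
  module F₁ = Frame K b₁ s₁ c
  module F₂ = Frame K b₂ s₂ c
  p = position K a<K+2
  q = position K j<K+2
  same : ∀ {a j} (p : Position K a) (q : Position K j) →
         pick p (F₁.top q) (F₁.middle q) (F₁.bottom q) ≡ pick p (F₂.top q) (F₂.middle q) (F₂.bottom q)
  same first       (inner j<K) = ω-cong K (λ l l<K → b₁≈b₂ l _ l<K j<K) s₁≈s₂
  same (inner a<K) (inner j<K) = b₁≈b₂ _ _ a<K j<K
  same (inner a<K) last        = s₁≈s₂ _ a<K
  same first       first       = refl
  same first       last        = refl
  same (inner _)   first       = refl
  same last        _           = refl

innerBlock : (ℕ → ℕ → Bool) → ℕ → ℕ → Bool
innerBlock g a j = g (suc a) (suc j)

lastColumn : ℕ → (ℕ → ℕ → Bool) → ℕ → Bool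
lastColumn K g a = g (suc a) (suc K)

innerBlock-upperTri : ∀ K g → UpperTriℕ (suc (suc K)) g → UpperTriℕ K (innerBlock g)
innerBlock-upperTri K g ut i j j<i i<K = ut (suc i) (suc j) (s<s j<i) (<⇒suc<2+ i<K)

innerBlock-symplectic : ∀ K g → UpperTriℕ (suc (suc K)) g → Symplecticℕ (suc (suc K)) g →
                        Symplecticℕ K (innerBlock g)
innerBlock-symplectic K g ut sp i j i<K j<K = begin
  ω K (col (innerBlock g) i) (col (innerBlock g) j)
    ≡⟨ xor-identityʳ _ ⟨
  false xor (ω K (col (innerBlock g) i) (col (innerBlock g) j) xor false)
    ≡⟨ cong₂ (λ x y → x xor (ω K (col (innerBlock g) i) (col (innerBlock g) j) xor y))
             (cong (_∧ g 0 (suc j)) (bottom≡false i<K)) (trans (cong (g 0 (suc i) ∧_) (bottom≡false j<K)) (∧-zeroʳ _)) ⟨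
  (g (suc K) (suc i) ∧ g 0 (suc j)) xor (ω K (col (innerBlock g) i) (col (innerBlock g) j) xor (g 0 (suc i) ∧ g (suc K) (suc j)))
    ≡⟨ ω-peel K (col g (suc i)) (col g (suc j)) ⟨
  ω (suc (suc K)) (col g (suc i)) (col g (suc j))
    ≡⟨ sp (suc i) (suc j) (<⇒suc<2+ i<K) (<⇒suc<2+ j<K) ⟩
  does (suc i + suc j ≟ suc K)
    ≡⟨ suc+suc-antidiagonal i j i<K ⟩
  does (i + j ≟ K ∸ 1) ∎
  where
  open ≡-Reasoning
  bottom≡false : ∀ {j} → j < K → g (suc K) (suc j) ≡ false
  bottom≡false l<K = ut (suc K) _ (s<s l<K) (n<1+n (suc K))

xor≡false⇒≡ : ∀ {x y} → x xor y ≡ false → x ≡ y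
xor≡false⇒≡ {false} {false} _ = refl
xor≡false⇒≡ {true}  {true}  _ = refl

frame-complete : ∀ K g → UpperTriℕ (suc (suc K)) g → Symplecticℕ (suc (suc K)) g →
  ∀ a j → a < suc (suc K) → j < suc (suc K) → g a j ≡ Frame.frame K (innerBlock g) (lastColumn K g) (g 0 (suc K)) a j
frame-complete K g ut sp a j a<K+2 j<K+2 = trans (entry p q) (sym (frame-pick p q))
  where
  p = position K a<K+2
  q = position K j<K+2
  open Frame K (innerBlock g) (lastColumn K g) (g 0 (suc K))
  diagonal : ∀ {i} → i < suc (suc K) → g i i ≡ true
  diagonal = upperTriSymplectic-diagonal (suc (suc K)) g ut sp _
  top-row : ∀ {j} → j < K → ρ j ≡ g 0 (suc j)
  top-row {j} j<K = xor≡false⇒≡ $ begin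
    ρ j xor g 0 (suc j)
      ≡⟨ cong₂ (λ x y → x xor (ρ j xor y)) (cong (_∧ g 0 (suc K)) (ut (suc K) (suc j) (s<s j<K) (n<1+n (suc K))))
               (trans (cong (g 0 (suc j) ∧_) (diagonal (n<1+n (suc K)))) (∧-identityʳ _)) ⟨
    (g (suc K) (suc j) ∧ g 0 (suc K)) xor (ρ j xor (g 0 (suc j) ∧ g (suc K) (suc K)))
      ≡⟨ ω-peel K (col g (suc j)) (col g (suc K)) ⟨
    ω (suc (suc K)) (col g (suc j)) (col g (suc K))
      ≡⟨ sp (suc j) (suc K) (<⇒suc<2+ j<K) (n<1+n (suc K)) ⟩
    does (suc j + suc K ≟ suc K)
      ≡⟨ dec-false (_ ≟ _) (m+1+n≢n j ∘ suc-injective) ⟩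
    false ∎
    where open ≡-Reasoning
  entry : ∀ {a j} (p : Position K a) (q : Position K j) → g a j ≡ pick p (top q) (middle q) (bottom q)
  entry first       first       = diagonal z<s
  entry first       (inner j<K) = sym (top-row j<K)
  entry first       last        = refl
  entry (inner a<K) first       = ut _ 0 z<s (<⇒suc<2+ a<K)
  entry (inner a<K) (inner j<K) = refl
  entry (inner a<K) last        = refl
  entry last        first       = ut (suc K) 0 z<s (n<1+n (suc K))
  entry last        (inner j<K) = ut (suc K) _ (s<s j<K) (n<1+n (suc K))
  entry last        last        = diagonal (n<1+n (suc K))

-- Counting 𝔹_C^+

length-unique : ∀ {A : Set} {xs ys : List A} → Unique xs → Unique ys →
                (∀ {x} → x ∈ xs → x ∈ ys) → (∀ {x} → x ∈ ys → x ∈ xs) → length xs ≡ length ys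
length-unique xs! ys! xs⊆ys ys⊆xs = ↭-length (∼bag⇒↭ (unique∧set⇒bag xs! ys! (mk⇔ xs⊆ys ys⊆xs)))

length-cartesianProductWith : ∀ {A B C : Set} (f : A → B → C) xs ys →
                              length (cartesianProductWith f xs ys) ≡ length xs * length ys
length-cartesianProductWith f []       ys = refl
length-cartesianProductWith f (x ∷ xs) ys =
  trans (length-++ (map (f x) ys)) (cong₂ _+_ (length-map (f x) ys) (length-cartesianProductWith f xs ys))

concatMap≡cartesianProductWith : ∀ {A B C : Set} (f : A → B → C) xs ys →
                                 concatMap (λ x → map (f x) ys) xs ≡ cartesianProductWith f xs ys
concatMap≡cartesianProductWith f []       ys = refl
concatMap≡cartesianProductWith f (x ∷ xs) ys = cong (map (f x) ys ++_) (concatMap≡cartesianProductWith f xs ys)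

allVecs-suc : ∀ {A : Set} (xs : List A) k → allVecs xs (suc k) ≡ cartesianProductWith _∷_ xs (allVecs xs k)
allVecs-suc xs k = concatMap≡cartesianProductWith _∷_ xs (allVecs xs k)

allVecs-unique : ∀ {A : Set} {xs : List A} → Unique xs → ∀ k → Unique (allVecs xs k)
allVecs-unique xs! zero                       = All.[] AllPairs.∷ AllPairs.[]
allVecs-unique {xs = xs} xs! (suc k) rewrite allVecs-suc xs k =
  cartesianProductWith⁺ _∷_ ∷-injective xs! (allVecs-unique xs! k)

∈-allVecs : ∀ {A : Set} {xs : List A} → (∀ x → x ∈ xs) → ∀ {k} (v : Vec A k) → v ∈ allVecs xs k
∈-allVecs           all∈ []                        = here refl
∈-allVecs {xs = xs} all∈ {suc k} (x ∷ v) rewrite allVecs-suc xs k =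
  ∈-cartesianProductWith⁺ _∷_ (all∈ x) (∈-allVecs all∈ v)

length-allVecs : ∀ {A : Set} (xs : List A) k → length (allVecs xs k) ≡ length xs ^ k
length-allVecs xs zero    = refl
length-allVecs xs (suc k) rewrite allVecs-suc xs k =
  trans (length-cartesianProductWith _∷_ xs (allVecs xs k)) (cong (length xs *_) (length-allVecs xs k))

bools : List Bool
bools = true ∷ false ∷ []

bools-unique : Unique bools
bools-unique = ((λ ()) All.∷ All.[]) AllPairs.∷ (All.[] AllPairs.∷ AllPairs.[])

∈-bools : ∀ x → x ∈ bools
∈-bools true  = here refl
∈-bools false = there (here refl)

allMats-unique : ∀ k → Unique (allMats k)
allMats-unique k = allVecs-unique (allVecs-unique bools-unique k) k

∈-allMats : ∀ k (A : Mat k) → A ∈ allMats k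
∈-allMats k = ∈-allVecs (∈-allVecs ∈-bools)

K+2≡ : ∀ n → suc n + suc n ≡ suc (suc (n + n))
K+2≡ n = cong suc (+-suc n n)

frameOf : ∀ n → Mat (n + n) × Vec Bool (n + n) × Bool → ℕ → ℕ → Bool
frameOf n (B′ , s , c) = Frame.frame (n + n) (B′ ⟦_,_⟧) (lookupOr false s) c

framed : ∀ n → Mat (n + n) × Vec Bool (n + n) × Bool → Mat (suc n + suc n)
framed n x = tabulateℕ (suc n + suc n) (frameOf n x)

framed-⟦⟧ : ∀ n x → (framed n x ⟦_,_⟧) ≈[ suc (suc (n + n)) ] frameOf n x
framed-⟦⟧ n x a b a<K+2 b<K+2 = tabulateℕ-⟦⟧ (suc n + suc n) (frameOf n x) a b
  (subst (a <_) (sym (K+2≡ n)) a<K+2) (subst (b <_) (sym (K+2≡ n)) b<K+2)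

unframed : ∀ n → Mat (suc n + suc n) → Mat (n + n) × Vec Bool (n + n) × Bool
unframed n B = tabulateℕ (n + n) (innerBlock (B ⟦_,_⟧))
             , tabulate (lastColumn (n + n) (B ⟦_,_⟧) ∘ toℕ)
             , B ⟦ 0 , suc (n + n) ⟧

unframed-framed : ∀ n x → unframed n (framed n x) ≡ x
unframed-framed n x@(B′ , s , c) = cong₂ _,_ inner-eq (cong₂ _,_ column-eq corner-eq)
  where
  open Frame (n + n) (B′ ⟦_,_⟧) (lookupOr false s) c
  K = n + n
  F = framed n x
  inner-eq : tabulateℕ K (innerBlock (F ⟦_,_⟧)) ≡ B′
  inner-eq = Mat-extℕ λ a b a<K b<K → trans (tabulateℕ-⟦⟧ K _ a b a<K b<K)
    (trans (framed-⟦⟧ n x (suc a) (suc b) (<⇒suc<2+ a<K) (<⇒suc<2+ b<K)) (frame-pick (inner a<K) (inner b<K)))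
  column-eq : tabulate (lastColumn K (F ⟦_,_⟧) ∘ toℕ) ≡ s
  column-eq = trans (tabulate-cong λ i → trans (framed-⟦⟧ n x (suc (toℕ i)) (suc K) (<⇒suc<2+ (toℕ<n i)) (n<1+n (suc K)))
                                          (trans (frame-pick (inner (toℕ<n i)) last) (lookupOr-toℕ false s i)))
                    (tabulate∘lookup s)
  corner-eq : F ⟦ 0 , suc K ⟧ ≡ c
  corner-eq = trans (framed-⟦⟧ n x 0 (suc K) z<s (n<1+n (suc K))) (frame-pick first last)

framed-injective : ∀ n {x y} → framed n x ≡ framed n y → x ≡ y
framed-injective n {x} {y} eq = trans (sym (unframed-framed n x)) (trans (cong (unframed n) eq) (unframed-framed n y))

framed-InBplus : ∀ n {B′} s c → InBplus n B′ → InBplus (suc n) (framed n (B′ , s , c))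
framed-InBplus n {B′} s c B′∈ = ℕ⇒InBplus (suc n) (framed n x)
  (subst (λ k → UpperTriℕ k (framed n x ⟦_,_⟧)) (sym (K+2≡ n)) (UpperTriℕ-resp agree (frame-upperTri ut)))
  (subst (λ k → Symplecticℕ k (framed n x ⟦_,_⟧)) (sym (K+2≡ n))
         (Symplecticℕ-resp agree (frame-symplectic sp (ω-alternating n (lookupOr false s)))))
  where
  open Frame (n + n) (B′ ⟦_,_⟧) (lookupOr false s) c
  x = B′ , s , c
  ut = proj₁ (InBplus⇒ℕ n B′ B′∈)
  sp = proj₂ (InBplus⇒ℕ n B′ B′∈)
  agree : frame ≈[ suc (suc (n + n)) ] (framed n x ⟦_,_⟧)
  agree a b a< b< = sym (framed-⟦⟧ n x a b a< b<)

module _ (n : ℕ) (B : Mat (suc n + suc n)) (B∈ : InBplus (suc n) B) where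
  private
    K = n + n
    ut = subst (λ k → UpperTriℕ k (B ⟦_,_⟧)) (K+2≡ n) (proj₁ (InBplus⇒ℕ (suc n) B B∈))
    sp = subst (λ k → Symplecticℕ k (B ⟦_,_⟧)) (K+2≡ n) (proj₂ (InBplus⇒ℕ (suc n) B B∈))
    inner≈ : innerBlock (B ⟦_,_⟧) ≈[ K ] (proj₁ (unframed n B) ⟦_,_⟧)
    inner≈ a b a<K b<K = sym (tabulateℕ-⟦⟧ K _ a b a<K b<K)

  unframed-InBplus : InBplus n (proj₁ (unframed n B))
  unframed-InBplus = ℕ⇒InBplus n _ (UpperTriℕ-resp inner≈ (innerBlock-upperTri K _ ut))
                                    (Symplecticℕ-resp inner≈ (innerBlock-symplectic K _ ut sp))

  framed-unframed : framed n (unframed n B) ≡ B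
  framed-unframed = Mat-extℕ λ a b a< b< → entry (subst (a <_) (K+2≡ n) a<) (subst (b <_) (K+2≡ n) b<)
    where
    open ≡-Reasoning
    x = unframed n B
    last≈ : ∀ a → a < K → lastColumn K (B ⟦_,_⟧) a ≡ lookupOr false (proj₁ (proj₂ x)) a
    last≈ a a<K = sym (lookupOr-tabulate false (lastColumn K (B ⟦_,_⟧)) a<K)
    entry : ∀ {a b} → a < suc (suc K) → b < suc (suc K) → framed n x ⟦ a , b ⟧ ≡ B ⟦ a , b ⟧
    entry {a} {b} a<K+2 b<K+2 = begin
      framed n x ⟦ a , b ⟧
        ≡⟨ framed-⟦⟧ n x a b a<K+2 b<K+2 ⟩
      frameOf n x a b
        ≡⟨ frame-cong K (B ⟦ 0 , suc K ⟧) inner≈ last≈ a b a<K+2 b<K+2 ⟨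
      Frame.frame K (innerBlock (B ⟦_,_⟧)) (lastColumn K (B ⟦_,_⟧)) (B ⟦ 0 , suc K ⟧) a b
        ≡⟨ frame-complete K (B ⟦_,_⟧) ut sp a b a<K+2 b<K+2 ⟨
      B ⟦ a , b ⟧ ∎

borelList : ∀ n → List (Mat (n + n))
borelList zero    = [] ∷ []
borelList (suc n) = map (framed n) (cartesianProduct (borelList n) (cartesianProduct (allVecs bools (n + n)) bools))

borelList-unique : ∀ n → Unique (borelList n)
borelList-unique zero    = All.[] AllPairs.∷ AllPairs.[]
borelList-unique (suc n) = map⁺ (framed-injective n)
  (cartesianProduct⁺ (borelList-unique n) (cartesianProduct⁺ (allVecs-unique bools-unique (n + n)) bools-unique))

∈-borelList⇒InBplus : ∀ n {B} → B ∈ borelList n → InBplus n B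
∈-borelList⇒InBplus zero    (here refl) = ℕ⇒InBplus 0 [] (λ _ _ _ ()) (λ _ _ ())
∈-borelList⇒InBplus (suc n) B∈ with ∈-map⁻ (framed n) B∈
... | (B′ , s , c) , B′sc∈ , refl =
  framed-InBplus n s c (∈-borelList⇒InBplus n (proj₁ (∈-cartesianProduct⁻ (borelList n) _ B′sc∈)))

InBplus⇒∈-borelList : ∀ n {B} → InBplus n B → B ∈ borelList n
InBplus⇒∈-borelList zero    {[]} _  = here refl
InBplus⇒∈-borelList (suc n) {B} B∈ = subst (_∈ borelList (suc n)) (framed-unframed n B B∈)
  (∈-map⁺ (framed n) (∈-cartesianProduct⁺ (InBplus⇒∈-borelList n (unframed-InBplus n B B∈))
                                          (∈-cartesianProduct⁺ (∈-allVecs ∈-bools (proj₁ (proj₂ (unframed n B)))) (∈-bools _))))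

length-borelList : ∀ n → length (borelList n) ≡ 2 ^ (n * n)
length-borelList zero    = refl
length-borelList (suc n) = begin
  length (borelList (suc n))
    ≡⟨ length-map (framed n) (cartesianProduct (borelList n) (cartesianProduct (allVecs bools (n + n)) bools)) ⟩
  length (cartesianProduct (borelList n) (cartesianProduct (allVecs bools (n + n)) bools))
    ≡⟨ length-cartesianProductWith _,_ (borelList n) _ ⟩
  length (borelList n) * length (cartesianProduct (allVecs bools (n + n)) bools)
    ≡⟨ cong₂ _*_ (length-borelList n) (length-cartesianProductWith _,_ (allVecs bools (n + n)) bools) ⟩
  2 ^ (n * n) * (length (allVecs bools (n + n)) * 2)
    ≡⟨ cong (λ t → 2 ^ (n * n) * (t * 2)) (length-allVecs bools (n + n)) ⟩
  2 ^ (n * n) * (2 ^ (n + n) * 2)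
    ≡⟨ cong (2 ^ (n * n) *_) (*-comm (2 ^ (n + n)) 2) ⟩
  2 ^ (n * n) * 2 ^ suc (n + n)
    ≡⟨ ^-distribˡ-+-* 2 (n * n) (suc (n + n)) ⟨
  2 ^ (n * n + suc (n + n))
    ≡⟨ cong (2 ^_) (exponent n) ⟩
  2 ^ (suc n * suc n) ∎
  where
  open ≡-Reasoning
  exponent : ∀ n → n * n + suc (n + n) ≡ suc n * suc n
  exponent = solve-∀

cardBplus≡ : ∀ n → cardBplus n ≡ 2 ^ (n * n)
cardBplus≡ n = trans (length-unique (filter⁺ (InBplus? n) {xs = allMats (n + n)} (allMats-unique (n + n))) (borelList-unique n)
  (λ B∈ → InBplus⇒∈-borelList n (proj₂ (∈-filter⁻ (InBplus? n) {xs = allMats (n + n)} B∈)))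
  (λ B∈ → ∈-filter⁺ (InBplus? n) (∈-allMats _ _) (∈-borelList⇒InBplus n B∈)))
  (length-borelList n)

-- Parity of the number of ones

bit-xor : ∀ x y → (bit x + bit y) % 2 ≡ bit (x xor y)
bit-xor true  true  = refl
bit-xor true  false = refl
bit-xor false true  = refl
bit-xor false false = refl

bit%2 : ∀ x → bit x % 2 ≡ bit x
bit%2 true  = refl
bit%2 false = refl

Σℕ-parity : ∀ K (g : Fin K → ℕ) (f : Fin K → Bool) → (∀ i → g i % 2 ≡ bit (f i)) → Σℕ K g % 2 ≡ bit (Σ₂ K f)
Σℕ-parity zero    g f g≡f = refl
Σℕ-parity (suc K) g f g≡f = begin
  (g zero + Σℕ K (g ∘ suc)) % 2
    ≡⟨ %-distribˡ-+ (g zero) (Σℕ K (g ∘ suc)) 2 ⟩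
  (g zero % 2 + Σℕ K (g ∘ suc) % 2) % 2
    ≡⟨ cong₂ (λ x y → (x + y) % 2) (g≡f zero) (Σℕ-parity K (g ∘ suc) (f ∘ suc) (g≡f ∘ suc)) ⟩
  (bit (f zero) + bit (Σ₂ K (f ∘ suc))) % 2
    ≡⟨ bit-xor (f zero) (Σ₂ K (f ∘ suc)) ⟩
  bit (Σ₂ (suc K) f) ∎
  where open ≡-Reasoning

colParity : ∀ {K} → Mat K → ℕ → Bool
colParity {K} A b = ⨁ K (λ a → A ⟦ a , b ⟧)

colOnes-parity : ∀ {K} (A : Mat K) j → colOnes A j % 2 ≡ bit (colParity A (toℕ j))
colOnes-parity {K} A j = trans (Σℕ-parity K _ (λ i → A [ i , j ]) (λ i → bit%2 _))
  (cong bit (trans (Σ₂-cong K (λ i → sym (⟦⟧-toℕ A i j))) (Σ₂≡⨁ K (λ a → A ⟦ a , toℕ j ⟧))))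

ones-parity : ∀ {K} (A : Mat K) → ones A % 2 ≡ bit (⨁ K (colParity A))
ones-parity {K} A = trans (Σℕ-parity K _ (λ i → Σ₂ K (λ j → A [ i , j ])) (λ i → Σℕ-parity K _ _ (λ j → bit%2 _)))
  (cong bit (begin
    Σ₂ K (λ i → Σ₂ K (λ j → A [ i , j ]))              ≡⟨ Σ₂-cong K (λ i → Σ₂-cong K (λ j → sym (⟦⟧-toℕ A i j))) ⟩
    Σ₂ K (λ i → Σ₂ K (λ j → A ⟦ toℕ i , toℕ j ⟧))      ≡⟨ Σ₂-cong K (λ i → Σ₂≡⨁ K (λ b → A ⟦ toℕ i , b ⟧)) ⟩
    Σ₂ K (λ i → ⨁ K (λ b → A ⟦ toℕ i , b ⟧))           ≡⟨ Σ₂≡⨁ K (λ a → ⨁ K (λ b → A ⟦ a , b ⟧)) ⟩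
    ⨁ K (λ a → ⨁ K (λ b → A ⟦ a , b ⟧))                ≡⟨ ⨁-swap K K (A ⟦_,_⟧) ⟩
    ⨁ K (colParity A)                                  ∎))
  where open ≡-Reasoning

colParity-*ᴹ : ∀ {K} (A B : Mat K) b → b < K → colParity (A *ᴹ B) b ≡ ⨁ K (λ l → colParity A l ∧ B ⟦ l , b ⟧)
colParity-*ᴹ {K} A B b b<K = begin
  ⨁ K (λ a → (A *ᴹ B) ⟦ a , b ⟧)                     ≡⟨ ⨁-cong K (λ a a<K → *ᴹ-⟦⟧ A B a b a<K b<K) ⟩
  ⨁ K (λ a → ⨁ K (λ l → A ⟦ a , l ⟧ ∧ B ⟦ l , b ⟧))   ≡⟨ ⨁-swap K K _ ⟩
  ⨁ K (λ l → ⨁ K (λ a → A ⟦ a , l ⟧ ∧ B ⟦ l , b ⟧))   ≡⟨ ⨁-cong K (λ l _ → ⨁-∧ʳ K (B ⟦ l , b ⟧) _) ⟩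
  ⨁ K (λ l → colParity A l ∧ B ⟦ l , b ⟧)            ∎
  where open ≡-Reasoning

ones-*ᴹ-odd : ∀ {K} (A B : Mat K) → 1 ≤ K → (∀ b → b < K → colParity A b ≡ does (b ≟ K ∸ 1)) →
              UpperTriℕ K (B ⟦_,_⟧) → B ⟦ K ∸ 1 , K ∸ 1 ⟧ ≡ true → ones (A *ᴹ B) % 2 ≡ 1
ones-*ᴹ-odd {K} A B 1≤K colParity-A ut B-corner = trans (ones-parity (A *ᴹ B)) (cong bit (begin
  ⨁ K (colParity (A *ᴹ B))
    ≡⟨ ⨁-cong K (λ b b<K → colParity-*ᴹ A B b b<K) ⟩
  ⨁ K (λ b → ⨁ K (λ l → colParity A l ∧ B ⟦ l , b ⟧))
    ≡⟨ ⨁-cong K (λ b _ → ⨁-cong K (λ l l<K → cong (_∧ B ⟦ l , b ⟧) (colParity-A l l<K))) ⟩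
  ⨁ K (λ b → ⨁ K (λ l → does (l ≟ m) ∧ B ⟦ l , b ⟧))
    ≡⟨ ⨁-cong K (λ b _ → ⨁-indicator K (B ⟦_, b ⟧) m<K) ⟩
  ⨁ K (λ b → B ⟦ m , b ⟧)
    ≡⟨ ⨁-single K _ m<K (λ b b<K b≢m → ut m b (≤∧≢⇒< (<⇒≤∸1 b<K) b≢m) m<K) ⟩
  B ⟦ m , m ⟧
    ≡⟨ B-corner ⟩
  true ∎))
  where
  open ≡-Reasoning
  m = K ∸ 1
  m<K : m < K
  m<K = ∸1< 1≤K

colParity-*permMat : ∀ {K} (A : Mat K) (π : Permutation′ K) j →
                     colParity (A *ᴹ permMat π) (toℕ j) ≡ colParity A (toℕ (π ⟨$⟩ʳ j))
colParity-*permMat {K} A π j = begin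
  colParity (A *ᴹ permMat π) (toℕ j)
    ≡⟨ colParity-*ᴹ A (permMat π) (toℕ j) (toℕ<n j) ⟩
  ⨁ K (λ l → colParity A l ∧ permMat π ⟦ l , toℕ j ⟧)
    ≡⟨ Σ₂≡⨁ K _ ⟨
  Σ₂ K (λ l → colParity A (toℕ l) ∧ permMat π ⟦ toℕ l , toℕ j ⟧)
    ≡⟨ Σ₂-cong K (λ l → cong (colParity A (toℕ l) ∧_) (permMat-⟦⟧ l)) ⟩
  Σ₂ K (λ l → colParity A (toℕ l) ∧ does (l ≟ᶠ π ⟨$⟩ʳ j))
    ≡⟨ Σ₂-indicator K _ (π ⟨$⟩ʳ j) ⟩
  colParity A (toℕ (π ⟨$⟩ʳ j)) ∎
  where
  open ≡-Reasoning
  permMat-⟦⟧ : ∀ l → permMat π ⟦ toℕ l , toℕ j ⟧ ≡ does (l ≟ᶠ π ⟨$⟩ʳ j)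
  permMat-⟦⟧ l = trans (⟦⟧-toℕ (permMat π) l j) (mkMat-[] _ l j)

colParity-lowerUni-last : ∀ {K} (u : Mat K) → LowerUni u → 1 ≤ K → colParity u (K ∸ 1) ≡ true
colParity-lowerUni-last {K} u (upper≡0 , diagonal) 1≤K = trans (⨁-single K _ m<K above-diagonal) corner
  where
  m = K ∸ 1
  m<K : m < K
  m<K = ∸1< 1≤K
  above-diagonal : ∀ a → a < K → a ≢ m → u ⟦ a , m ⟧ ≡ false
  above-diagonal a a<K a≢m = fromFin₂ (λ a b → a < b → u ⟦ a , b ⟧ ≡ false)
    (λ i j i<j → trans (⟦⟧-toℕ u i j) (upper≡0 i j i<j)) a m a<K m<K (≤∧≢⇒< (<⇒≤∸1 a<K) a≢m)
  corner : u ⟦ m , m ⟧ ≡ true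
  corner = subst (λ t → u ⟦ t , t ⟧ ≡ true) (toℕ-fromℕ< m<K) (trans (⟦⟧-toℕ u _ _) (diagonal (fromℕ< m<K)))

-- Right multiplication by [π] permutes column parities, so exactly one column of u[π] is odd (the image
-- of the last column of u); the hypothesis forces it to be the last one.
colParity-evenExceptLast : ∀ {K} (u : Mat K) (π : Permutation′ K) → 1 ≤ K → LowerUni u →
  (∀ j → toℕ j < K ∸ 1 → colOnes (u *ᴹ permMat π) j % 2 ≡ 0) →
  ∀ b → b < K → colParity (u *ᴹ permMat π) b ≡ does (b ≟ K ∸ 1)
colParity-evenExceptLast {K} u π 1≤K lowerUni evenCols b b<K =
  subst (λ t → colParity Ã t ≡ does (t ≟ m)) (toℕ-fromℕ< b<K) (parity (fromℕ< b<K))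
  where
  Ã = u *ᴹ permMat π
  m = K ∸ 1
  m<K : m < K
  m<K = ∸1< 1≤K
  even : ∀ j → toℕ j < m → colParity Ã (toℕ j) ≡ false
  even j j<m = bit≡0 (trans (sym (colOnes-parity Ã j)) (evenCols j j<m))
    where
    bit≡0 : ∀ {x} → bit x ≡ 0 → x ≡ false
    bit≡0 {false} _ = refl
  j₀ = π ⟨$⟩ˡ fromℕ< m<K
  odd-j₀ : colParity Ã (toℕ j₀) ≡ true
  odd-j₀ = trans (colParity-*permMat u π j₀)
    (trans (cong (colParity u) (trans (cong toℕ (inverseʳ π)) (toℕ-fromℕ< m<K))) (colParity-lowerUni-last u lowerUni 1≤K))
  j₀-last : toℕ j₀ ≡ m
  j₀-last with toℕ j₀ <? m
  ... | yes j₀<m = contradiction (trans (sym odd-j₀) (even j₀ j₀<m)) λ ()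
  ... | no  j₀≮m = ≤-antisym (<⇒≤∸1 (toℕ<n j₀)) (≮⇒≥ j₀≮m)
  parity : ∀ j → colParity Ã (toℕ j) ≡ does (toℕ j ≟ m)
  parity j with toℕ j <? m
  ... | yes j<m = trans (even j j<m) (sym (dec-false (toℕ j ≟ m) (<⇒≢ j<m)))
  ... | no  j≮m = trans (cong (colParity Ã ∘ toℕ) j≡j₀) (trans odd-j₀ (sym (dec-true (toℕ j ≟ m) j-last)))
    where
    j-last = ≤-antisym (<⇒≤∸1 (toℕ<n j)) (≮⇒≥ j≮m)
    j≡j₀ = toℕ-injective (trans j-last (sym j₀-last))

IsLeftInverse : ∀ {K} → Mat K → Mat K → Set
IsLeftInverse {K} L A = ∀ a b → a < K → b < K → (L *ᴹ A) ⟦ a , b ⟧ ≡ does (a ≟ b)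

*ᴹ-cancelˡ : ∀ {K} (L A : Mat K) → IsLeftInverse L A → ∀ {X Y} → A *ᴹ X ≡ A *ᴹ Y → X ≡ Y
*ᴹ-cancelˡ {K} L A L*A≡I {X} {Y} AX≡AY = Mat-extℕ λ a b a<K b<K →
  trans (sym (L*A*-⟦⟧ X a<K b<K)) (trans (cong (λ Z → (L *ᴹ Z) ⟦ a , b ⟧) AX≡AY) (L*A*-⟦⟧ Y a<K b<K))
  where
  L*A*-⟦⟧ : ∀ Z {a b} → a < K → b < K → (L *ᴹ (A *ᴹ Z)) ⟦ a , b ⟧ ≡ Z ⟦ a , b ⟧
  L*A*-⟦⟧ Z {a} {b} a<K b<K = begin
    (L *ᴹ (A *ᴹ Z)) ⟦ a , b ⟧
      ≡⟨ cong (_⟦ a , b ⟧) (*ᴹ-assoc L A Z) ⟨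
    ((L *ᴹ A) *ᴹ Z) ⟦ a , b ⟧
      ≡⟨ *ᴹ-⟦⟧ (L *ᴹ A) Z a b a<K b<K ⟩
    ⨁ K (λ l → (L *ᴹ A) ⟦ a , l ⟧ ∧ Z ⟦ l , b ⟧)
      ≡⟨ ⨁-cong K (λ l l<K → cong (_∧ Z ⟦ l , b ⟧) (trans (L*A≡I a l a<K l<K) (≟-sym a l))) ⟩
    ⨁ K (λ l → does (l ≟ a) ∧ Z ⟦ l , b ⟧)
      ≡⟨ ⨁-indicator K (Z ⟦_, b ⟧) a<K ⟩
    Z ⟦ a , b ⟧ ∎
    where
    open ≡-Reasoning
    ≟-sym : ∀ x y → does (x ≟ y) ≡ does (y ≟ x)
    ≟-sym x y = does-⇔ (mk⇔ sym sym) (x ≟ y) (y ≟ x)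

-- M uᵀ M, the inverse of a symplectic u since M² = 1 over Z₂.
symplecticInverse : ∀ K → Mat K → Mat K
symplecticInverse K u = tabulateℕ K (λ a b → u ⟦ K ∸ 1 ∸ b , K ∸ 1 ∸ a ⟧)

symplecticInverse-isLeftInverse : ∀ K (u : Mat K) → Symplecticℕ K (u ⟦_,_⟧) → IsLeftInverse (symplecticInverse K u) u
symplecticInverse-isLeftInverse K u sp a b a<K b<K = begin
  (symplecticInverse K u *ᴹ u) ⟦ a , b ⟧
    ≡⟨ *ᴹ-⟦⟧ (symplecticInverse K u) u a b a<K b<K ⟩
  ⨁ K (λ l → symplecticInverse K u ⟦ a , l ⟧ ∧ u ⟦ l , b ⟧)
    ≡⟨ ⨁-cong K (λ l l<K → cong (_∧ u ⟦ l , b ⟧) (tabulateℕ-⟦⟧ K (λ a b → u ⟦ K ∸ 1 ∸ b , K ∸ 1 ∸ a ⟧) a l a<K l<K)) ⟩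
  ω K (col (u ⟦_,_⟧) (m ∸ a)) (col (u ⟦_,_⟧) b)
    ≡⟨ sp (m ∸ a) b (∸1∸-< a<K) b<K ⟩
  does (m ∸ a + b ≟ m)
    ≡⟨ does-⇔ (mk⇔ cancel (λ a≡b → trans (cong (λ t → m ∸ a + t) (sym a≡b)) (m∸n+n≡m a≤m))) (m ∸ a + b ≟ m) (a ≟ b) ⟩
  does (a ≟ b) ∎
  where
  open ≡-Reasoning
  m = K ∸ 1
  a≤m = <⇒≤∸1 a<K
  cancel : m ∸ a + b ≡ m → a ≡ b
  cancel eq = sym (+-cancelˡ-≡ (m ∸ a) b a (trans eq (sym (m∸n+n≡m a≤m))))

permMat-isLeftInverse : ∀ {K} (π : Permutation′ K) → IsLeftInverse (permMat (flip π)) (permMat π)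
permMat-isLeftInverse {K} π = fromFin₂ (λ a b → (permMat (flip π) *ᴹ permMat π) ⟦ a , b ⟧ ≡ does (a ≟ b)) λ i j → begin
  (permMat (flip π) *ᴹ permMat π) ⟦ toℕ i , toℕ j ⟧
    ≡⟨ ⟦⟧-toℕ (permMat (flip π) *ᴹ permMat π) i j ⟩
  (permMat (flip π) *ᴹ permMat π) [ i , j ]
    ≡⟨ mkMat-[] _ i j ⟩
  Σ₂ K (λ l → permMat (flip π) [ i , l ] ∧ permMat π [ l , j ])
    ≡⟨ Σ₂-cong K (λ l → cong₂ _∧_ (permMat-[] (flip π) i l) (permMat-[] π l j)) ⟩
  Σ₂ K (λ l → does (i ≟ᶠ flip π ⟨$⟩ʳ l) ∧ does (l ≟ᶠ π ⟨$⟩ʳ j))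
    ≡⟨ Σ₂-indicator K _ (π ⟨$⟩ʳ j) ⟩
  does (i ≟ᶠ flip π ⟨$⟩ʳ (π ⟨$⟩ʳ j))
    ≡⟨ cong (λ t → does (i ≟ᶠ t)) (inverseˡ π) ⟩
  does (i ≟ᶠ j)
    ≡⟨ does-⇔ (mk⇔ (cong toℕ) toℕ-injective) (i ≟ᶠ j) (toℕ i ≟ toℕ j) ⟩
  does (toℕ i ≟ toℕ j) ∎
  where
  open ≡-Reasoning
  permMat-[] : ∀ (σ : Permutation′ K) l j → permMat σ [ l , j ] ≡ does (l ≟ᶠ σ ⟨$⟩ʳ j)
  permMat-[] σ = mkMat-[] (λ l j → does (l ≟ᶠ σ ⟨$⟩ʳ j))

sumℤ-sign-odd : ∀ {K} (xs : List (Mat K)) → (∀ {X} → X ∈ xs → ones X % 2 ≡ 1) →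
                sumℤ (map (λ X → sign (ones X)) xs) ≡ - (+ length xs)
sumℤ-sign-odd []       _   = refl
sumℤ-sign-odd (X ∷ xs) odd = trans (cong₂ _+ℤ_ (sign-odd (ones X) (odd (here refl))) (sumℤ-sign-odd xs (odd ∘ there)))
                                   (-1+-suc (length xs))
  where
  sign-odd : ∀ m → m % 2 ≡ 1 → sign m ≡ -[1+ 0 ]
  sign-odd (suc zero)    _   = refl
  sign-odd (suc (suc m)) odd =
    trans (sym (ℤP.*-assoc -[1+ 0 ] -[1+ 0 ] (sign m))) (trans (ℤP.*-identityˡ (sign m)) (sign-odd m odd))
  -1+-suc : ∀ k → -[1+ 0 ] +ℤ - (+ k) ≡ - (+ suc k)
  -1+-suc zero    = refl
  -1+-suc (suc k) = refl

∈-BplusList⇒InBplus : ∀ n {B} → B ∈ BplusList n → InBplus n B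
∈-BplusList⇒InBplus n B∈ = proj₂ (∈-filter⁻ (InBplus? n) {xs = allMats (n + n)} B∈)

cosetSignSum-odd : ∀ n (At : Mat (n + n)) → (∀ {X Y} → At *ᴹ X ≡ At *ᴹ Y → X ≡ Y) →
                   (∀ B → InBplus n B → ones (At *ᴹ B) % 2 ≡ 1) → cosetSignSum n At ≡ - (+ cardBplus n)
cosetSignSum-odd n At At-injective odd = trans (sumℤ-sign-odd (cosetList n At) coset-odd) (cong (λ k → - (+ k)) same-length)
  where
  ∈-image : ∀ {X} → X ∈ cosetList n At → X ∈ map (At *ᴹ_) (BplusList n)
  ∈-image X∈ = Any.map⁺ (proj₂ (∈-filter⁻ (InCoset? n At) {xs = allMats (n + n)} X∈))
  coset-odd : ∀ {X} → X ∈ cosetList n At → ones X % 2 ≡ 1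
  coset-odd X∈ with ∈-map⁻ (At *ᴹ_) (∈-image X∈)
  ... | B , B∈ , refl = odd B (∈-BplusList⇒InBplus n B∈)
  same-length : length (cosetList n At) ≡ cardBplus n
  same-length = trans (length-unique (filter⁺ (InCoset? n At) {xs = allMats (n + n)} (allMats-unique (n + n)))
                                     (map⁺ At-injective (filter⁺ (InBplus? n) {xs = allMats (n + n)} (allMats-unique (n + n))))
                                     ∈-image
                                     (λ X∈ → ∈-filter⁺ (InCoset? n At) (∈-allMats _ _) (Any.map⁻ X∈)))
                      (length-map (At *ᴹ_) (BplusList n))

lemma4p4 : (n : ℕ) → 1 ≤ n →
  (π : Permutation′ (n + n)) → InBn n π →
  (u : Mat (n + n)) → InUpi n π u →
  let At = u *ᴹ permMat π in
  (∀ (j : Fin (n + n)) → toℕ j < (n + n) ∸ 1 → colOnes At j % 2 ≡ 0) →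
  (∀ (B : Mat (n + n)) → InBplus n B → ones (At *ᴹ B) % 2 ≡ 1)
  × (cosetSignSum n At ≡ - (+ cardBplus n))
  × (cardBplus n ≡ 2 ^ (n * n))
lemma4p4 n 1≤n π _ u ((lowerUni , _ , uᵀMu≡M) , _) evenCols =
  odd , cosetSignSum-odd n Ã Ã-injective odd , cardBplus≡ n
  where
  K = n + n
  Ã = u *ᴹ permMat π
  1≤K = ≤-trans 1≤n (m≤m+n n n)
  odd : ∀ B → InBplus n B → ones (Ã *ᴹ B) % 2 ≡ 1
  odd B B∈ with InBplus⇒ℕ n B B∈
  ... | ut , sp = ones-*ᴹ-odd Ã B 1≤K (colParity-evenExceptLast u π 1≤K lowerUni evenCols) ut
                    (upperTriSymplectic-diagonal K _ ut sp (K ∸ 1) (∸1< 1≤K))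
  Ã-injective : ∀ {X Y} → Ã *ᴹ X ≡ Ã *ᴹ Y → X ≡ Y
  Ã-injective {X} {Y} ÃX≡ÃY =
    *ᴹ-cancelˡ (permMat (flip π)) (permMat π) (permMat-isLeftInverse π)
      (*ᴹ-cancelˡ (symplecticInverse K u) u (symplecticInverse-isLeftInverse K u (symplectic⇒Symplecticℕ n u uᵀMu≡M))
        (trans (sym (*ᴹ-assoc u (permMat π) X)) (trans ÃX≡ÃY (*ᴹ-assoc u (permMat π) Y))))
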